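{- The polynomials in $\mathbb{Z}[x_1,\ldots , x_n]$ that are both a fundamental (respectively, monomial) slide polynomial and a Young fundamental (respectively, monomial) slide polynomial are exactly the fundamental (respectively, monomial) quasisymmetric polynomials in $n$ variables. In other words, $\{\mathfrak F_a\}\cap \{\hat{\mathfrak F}_b\} = \{F_\alpha(x_1, \ldots , x_n)\}$ and $\{\mathfrak M_a\}\cap \{\hat{\mathfrak M}_b\} = \{M_\alpha(x_1, \ldots , x_n)\}$.
   Context: Weak compositions have length $n$. The fundamental slide polynomial $\mathfrak F_a$ is the generating function of fillings of the diagram of $a$ (row $i$ has $a_i$ left-justified boxes) with positive entries, rows weakly decreasing, no entry in row $i$ greater than $i$, and every entry in a lower row strictly smaller than every entry in a higher row; the monomial slide polynomial $\mathfrak M_a$ uses the subset of these fillings with all entries in a row equal. The Young versions are $\hat{\mathfrak F}_a(x_1,\ldots,x_n)=\mathfrak F_{\mathrm{rev}(a)}(x_n,\ldots,x_1)$ and $\hat{\mathfrak M}_a(x_1,\ldots,x_n)=\mathfrak M_{\mathrm{rev}(a)}(x_n,\ldots,x_1)$, $\mathrm{rev}$ denoting reversal (equivalently generated by fillings with entries in $\{1,\ldots,n\}$, rows weakly increasing, entries in row $i$ at least $i$, lower-row entries strictly smaller than higher-row entries, resp. also constant rows). $F_\alpha$ and $M_\alpha$ are Gessel's fundamental and monomial quasisymmetric polynomials, $\alpha$ ranging over compositions with at most $n$ parts. -}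

module Defs where

open import Data.Bool using (Bool; true; false; _∧_; if_then_else_)
open import Data.Nat using (ℕ; zero; suc; _+_; _≤_; _<_; _≤ᵇ_; _<ᵇ_; _≡ᵇ_)
open import Data.Nat.Properties using () renaming (_≟_ to _≟ℕ_)
open import Data.Fin using (Fin; toℕ)
open import Data.List using (List; []; _∷_; [_]; map; concatMap; upTo; length; filterᵇ; filter; concat)
open import Data.Bool.ListAction using (all; any)
open import Data.Nat.ListAction using (sum)
open import Data.List.Relation.Unary.All using (All)
open import Data.Vec using (Vec; toList; tabulate; reverse)
open import Data.Vec.Properties using (≡-dec)
open import Data.Product using (_×_; _,_)
open import Relation.Binary.PropositionalEquality using (_≡_)

-- Polynomials with nonnegative integer coefficients, represented as a
-- finite multiset (list) of monomials; the monomial x^c is given by its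
-- exponent vector c : Vec ℕ n (index k ↦ exponent of x_{k+1}).

Monomial : ℕ → Set
Monomial n = Vec ℕ n

Poly : ℕ → Set
Poly n = List (Monomial n)

coeff : ∀ {n} → Poly n → Monomial n → ℕ
coeff p c = length (filter (λ m → ≡-dec _≟ℕ_ m c) p)

infix 4 _≈ₚ_
_≈ₚ_ : ∀ {n} → Poly n → Poly n → Set
p ≈ₚ q = ∀ c → coeff p c ≡ coeff q c

lists : ℕ → ℕ → List (List ℕ)
lists zero    m = [ [] ]
lists (suc k) m = concatMap (λ e → map (e ∷_) (lists k m)) (map suc (upTo m))

product : {A : Set} → List (List A) → List (List A)
product []         = [ [] ]
product (xs ∷ xss) = concatMap (λ x → map (x ∷_) (product xss)) xs

countℕ : ℕ → List ℕ → ℕ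
countℕ k xs = length (filterᵇ (λ y → y ≡ᵇ k) xs)

-- A filling of the diagram of a weak composition a : Vec ℕ n is the
-- list of its rows, row 1 (the lowest row) first; row i is the list of
-- its a_i entries from left to right.

-- candidate fillings: row i filled arbitrarily with entries in {1,…,i}
-- (this already enforces "no entry in row i greater than i")
rowCandidates : ℕ → List ℕ → List (List (List ℕ))
rowCandidates i []       = []
rowCandidates i (k ∷ ks) = lists k i ∷ rowCandidates (suc i) ks

candidates : ∀ {n} → Vec ℕ n → List (List (List ℕ))
candidates a = product (rowCandidates 1 (toList a))

weaklyDecreasing : List ℕ → Bool
weaklyDecreasing (x ∷ y ∷ xs) = (y ≤ᵇ x) ∧ weaklyDecreasing (y ∷ xs)
weaklyDecreasing _            = true

weaklyIncreasing : List ℕ → Bool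
weaklyIncreasing (x ∷ y ∷ xs) = (x ≤ᵇ y) ∧ weaklyIncreasing (y ∷ xs)
weaklyIncreasing _            = true

strictlyIncreasing : List ℕ → Bool
strictlyIncreasing (x ∷ y ∷ xs) = (x <ᵇ y) ∧ strictlyIncreasing (y ∷ xs)
strictlyIncreasing _            = true

constantRow : List ℕ → Bool
constantRow []       = true
constantRow (x ∷ xs) = all (λ y → y ≡ᵇ x) xs

allSmaller : List ℕ → List ℕ → Bool
allSmaller r s = all (λ x → all (λ y → x <ᵇ y) s) r

rowsSeparated : List (List ℕ) → Bool
rowsSeparated []       = true
rowsSeparated (r ∷ rs) = all (allSmaller r) rs ∧ rowsSeparated rs

isFundFilling : List (List ℕ) → Bool
isFundFilling T = all weaklyDecreasing T ∧ rowsSeparated T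

isMonFilling : List (List ℕ) → Bool
isMonFilling T = isFundFilling T ∧ all constantRow T

weightOf : (n : ℕ) → List (List ℕ) → Monomial n
weightOf n T = tabulate (λ k → countℕ (suc (toℕ k)) (concat T))

fundSlide : ∀ {n} → Vec ℕ n → Poly n
fundSlide {n} a = map (weightOf n) (filterᵇ isFundFilling (candidates a))

monSlide : ∀ {n} → Vec ℕ n → Poly n
monSlide {n} a = map (weightOf n) (filterᵇ isMonFilling (candidates a))

reverseVars : ∀ {n} → Poly n → Poly n
reverseVars p = map reverse p

youngFundSlide : ∀ {n} → Vec ℕ n → Poly n
youngFundSlide b = reverseVars (fundSlide (reverse b))

youngMonSlide : ∀ {n} → Vec ℕ n → Poly n
youngMonSlide b = reverseVars (monSlide (reverse b))

IsComposition : ℕ → List ℕ → Set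
IsComposition n α = All (λ x → 0 < x) α × length α ≤ n

-- S(α) = {α₁, α₁+α₂, …, α₁+⋯+α_{ℓ-1}}
partialSumsFrom : ℕ → List ℕ → List ℕ
partialSumsFrom s []           = []
partialSumsFrom s (x ∷ [])     = []
partialSumsFrom s (x ∷ y ∷ xs) = (s + x) ∷ partialSumsFrom (s + x) (y ∷ xs)

descentSet : List ℕ → List ℕ
descentSet α = partialSumsFrom 0 α

memberᵇ : ℕ → List ℕ → Bool
memberᵇ k xs = any (λ y → y ≡ᵇ k) xs

-- i₁ ≤ i₂ ≤ ⋯ ≤ i_k with i_j < i_{j+1} whenever j ∈ S; j is the
-- (1-based) position of the first argument
fundSeqOk : List ℕ → ℕ → List ℕ → Bool
fundSeqOk S j (x ∷ y ∷ xs) =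
  (if memberᵇ j S then x <ᵇ y else x ≤ᵇ y) ∧ fundSeqOk S (suc j) (y ∷ xs)
fundSeqOk S j _ = true

seqMonomial : (n : ℕ) → List ℕ → Monomial n
seqMonomial n is = tabulate (λ k → countℕ (suc (toℕ k)) is)

fundQSym : (n : ℕ) → List ℕ → Poly n
fundQSym n α =
  map (seqMonomial n) (filterᵇ (fundSeqOk (descentSet α) 1) (lists (sum α) n))

expMonomial : (n : ℕ) → List ℕ → List ℕ → Monomial n
expMonomial n α is = tabulate (λ k → sumAt (suc (toℕ k)) α is)
  where
  sumAt : ℕ → List ℕ → List ℕ → ℕ
  sumAt k (a ∷ as) (i ∷ is′) = (if i ≡ᵇ k then a else 0) + sumAt k as is′
  sumAt k _        _          = 0

monQSym : (n : ℕ) → List ℕ → Poly n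
monQSym n α =
  map (expMonomial n α) (filterᵇ strictlyIncreasing (lists (length α) n))

-- A filling of the weak composition 0ᵏα (α without zeros), read row by row with each row reversed,
-- is a word whose row-length blocks are weakly increasing with strict ascents between blocks: exactly
-- the words defining F_α. Conversely, strict separation of the rows puts every such word back into the
-- diagram of 0ᵏα, so 𝔉_{0ᵏα} = F_α, and with constant rows 𝔐_{0ᵏα} = M_α. The Young slide polynomial
-- of α0ᵏ is F_{rev α} (resp. M_{rev α}) in reversed variables, which is F_α (resp. M_α) again via
-- i ↦ n + 1 − i on reversed words. Finally, if a positive entry of a is followed by a zero, x^a is a
-- term of 𝔉_a; were 𝔉_a also a Young slide polynomial, that gap would allow relabelling a filling into
-- a term of 𝔉_a whose partial sums fall below those of a, while every term of 𝔉_a dominates a.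

module Submission where

open import Defs

open import Data.Bool using (Bool; true; false; T; _∧_; _∨_; if_then_else_)
open import Data.Bool.Properties using (T?; T-∧; T-≡; ∧-assoc)
open import Data.Empty using (⊥; ⊥-elim)
open import Data.Fin using (toℕ)
open import Data.List
  using (List; []; _∷_; _++_; [_]; _∷ʳ_; take; drop; applyUpTo; applyDownFrom; map; concat; concatMap;
         filter; filterᵇ; length; upTo; reverse; replicate)
open import Data.List.Membership.Propositional using (_∈_)
open import Data.List.Membership.Propositional.Properties
  using (∈-filter⁺; ∈-filter⁻; ∈-∃++; ∈-++⁺ˡ; ∈-++⁺ʳ; ∈-++⁻; ∈-map⁺; ∈-map⁻; ∈-upTo⁺; ∈-upTo⁻; ∈-length)
open import Data.List.Properties
  using (∷-injective; ∷-injectiveˡ; ∷-injectiveʳ; length-++; length-map; length-reverse; length-replicate;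
         filter-accept; filter-reject; filter-++; map-∘; map-++; map-cong; map-replicate; concat-++; concat-map;
         ++-assoc; ++-identityʳ; unfold-reverse; reverse-++; reverse-map; reverse-involutive; reverse-applyUpTo;
         take++drop≡id)
open import Data.List.Relation.Binary.Permutation.Propositional
  using (_↭_; ↭-refl; ↭-sym; ↭-reflexive; module PermutationReasoning)
open import Data.List.Relation.Binary.Permutation.Propositional.Properties
  using (↭-length; ↭-reverse; ++⁺; ++-comm; filter-↭)
open import Data.List.Relation.Unary.All as All using (All; []; _∷_)
import Data.List.Relation.Unary.All.Properties as All
open import Data.List.Relation.Unary.AllPairs as AllPairs using (AllPairs; []; _∷_)
import Data.List.Relation.Unary.AllPairs.Properties as AllPairs
open import Data.List.Relation.Unary.Any using (here; there)
open import Data.List.Relation.Unary.Any.Properties using () renaming (reverse⁺ to ∈-reverse⁺; reverse⁻ to ∈-reverse⁻)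
open import Data.List.Relation.Unary.Linked using (Linked; []; [-]; _∷_)
open import Data.List.Relation.Unary.Linked.Properties using (AllPairs⇒Linked; Linked⇒AllPairs)
open import Data.List.Relation.Unary.Unique.Propositional using (Unique)
import Data.List.Relation.Unary.Unique.Propositional.Properties as Unique
open import Data.Nat using (ℕ; zero; suc; _+_; _∸_; _≤_; _<_; _≥_; z≤n; s≤s; z<s; s<s; _≤ᵇ_; _<ᵇ_; _≡ᵇ_)
open import Data.Nat.ListAction using (sum)
open import Data.Nat.ListAction.Properties using (sum-↭; sum-++)
open import Data.Nat.Properties
  using (≤-refl; ≤-reflexive; ≤-trans; ≤-antisym; ≤-pred; <-trans; <-≤-trans; ≤-<-trans; <⇒≤; <⇒≢; <⇒≱; ≤∧≢⇒<;
         n≤1+n; n<1+n; m≤m+n; m≤n+m; m<m+n; +-suc; +-comm; +-assoc; +-identityʳ; +-mono-≤; +-cancelˡ-≤;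
         suc-injective; m<n⇒0<n∸m; ∸-monoʳ-≤; ∸-monoʳ-<; m∸[m∸n]≡n; +-∸-assoc; m∸n≤m; m∸n+n≡m; m+[n∸m]≡n;
         ≡ᵇ⇒≡; ≡⇒≡ᵇ; ≤ᵇ⇒≤; ≤⇒≤ᵇ; <ᵇ⇒<; <⇒<ᵇ; module ≤-Reasoning)
  renaming (_≟_ to _≟ℕ_)
open import Data.Product using (_×_; _,_; proj₁; proj₂; Σ; ∃-syntax)
open import Data.Sum using (_⊎_; inj₁; inj₂)
open import Data.Unit using (⊤; tt)
open import Data.Vec using (Vec; toList)
import Data.Vec as Vec
open import Data.Vec.Properties using (≡-dec)
import Data.Vec.Properties as Vec
open import Function using (_∘_; flip; _⇔_; mk⇔; Equivalence)
open import Relation.Binary.Definitions using (Transitive)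
open import Relation.Binary.PropositionalEquality
  using (_≡_; _≢_; refl; sym; trans; cong; cong₂; subst; subst₂; module ≡-Reasoning)
open import Relation.Nullary using (Dec; yes; no; ¬_)
open import Relation.Nullary.Decidable using (_×-dec_)
open import Relation.Unary using (Decidable)

-- Coefficients counted along fibres

module _ {A : Set} {n : ℕ} (P : A → Bool) (w : A → Monomial n) (c : Monomial n) where

  InFibre : A → Set
  InFibre x = T (P x) × w x ≡ c

  inFibre? : Decidable InFibre
  inFibre? x = T? (P x) ×-dec ≡-dec _≟ℕ_ (w x) c

  coeff-map-filterᵇ : ∀ L → coeff (map w (filterᵇ P L)) c ≡ length (filter inFibre? L)
  coeff-map-filterᵇ [] = refl
  coeff-map-filterᵇ (x ∷ L) = step (T? (P x)) (≡-dec _≟ℕ_ (w x) c)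
    where
    count : List (Monomial n) → ℕ
    count ms = length (filter (λ m → ≡-dec _≟ℕ_ m c) ms)
    rest = coeff-map-filterᵇ L
    step : Dec (T (P x)) → Dec (w x ≡ c) → count (map w (filterᵇ P (x ∷ L))) ≡ length (filter inFibre? (x ∷ L))
    step (yes px) (yes wx) = begin
      count (map w (filterᵇ P (x ∷ L)))  ≡⟨ cong (count ∘ map w) (filter-accept (T? ∘ P) px) ⟩
      count (w x ∷ map w (filterᵇ P L))  ≡⟨ cong length (filter-accept (λ m → ≡-dec _≟ℕ_ m c) wx) ⟩
      suc (count (map w (filterᵇ P L)))  ≡⟨ cong suc rest ⟩
      suc (length (filter inFibre? L))   ≡⟨ cong length (filter-accept inFibre? (px , wx)) ⟨
      length (filter inFibre? (x ∷ L))   ∎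
      where open ≡-Reasoning
    step (yes px) (no ¬wx) = begin
      count (map w (filterᵇ P (x ∷ L)))  ≡⟨ cong (count ∘ map w) (filter-accept (T? ∘ P) px) ⟩
      count (w x ∷ map w (filterᵇ P L))  ≡⟨ cong length (filter-reject (λ m → ≡-dec _≟ℕ_ m c) ¬wx) ⟩
      count (map w (filterᵇ P L))        ≡⟨ rest ⟩
      length (filter inFibre? L)         ≡⟨ cong length (filter-reject inFibre? (¬wx ∘ proj₂)) ⟨
      length (filter inFibre? (x ∷ L))   ∎
      where open ≡-Reasoning
    step (no ¬px) _ = begin
      count (map w (filterᵇ P (x ∷ L)))  ≡⟨ cong (count ∘ map w) (filter-reject (T? ∘ P) ¬px) ⟩
      count (map w (filterᵇ P L))        ≡⟨ rest ⟩
      length (filter inFibre? L)         ≡⟨ cong length (filter-reject inFibre? (¬px ∘ proj₁)) ⟨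
      length (filter inFibre? (x ∷ L))   ∎
      where open ≡-Reasoning

length-≤-of-injection : ∀ {A B : Set} {X : List A} (Y : List B) → Unique X → (f : A → B) →
  (∀ {x} → x ∈ X → f x ∈ Y) → (∀ {x y} → x ∈ X → y ∈ X → f x ≡ f y → x ≡ y) → length X ≤ length Y
length-≤-of-injection {X = []} Y _ f into inj = z≤n
length-≤-of-injection {X = x ∷ X} Y (x∉X ∷ uX) f into inj with ∈-∃++ (into (here refl))
... | Y₁ , Y₂ , refl = begin
  suc (length X)              ≤⟨ s≤s (length-≤-of-injection (Y₁ ++ Y₂) uX f into′ (λ p q → inj (there p) (there q))) ⟩
  suc (length (Y₁ ++ Y₂))     ≡⟨ cong suc (length-++ Y₁) ⟩
  suc (length Y₁ + length Y₂) ≡⟨ +-suc (length Y₁) (length Y₂) ⟨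
  length Y₁ + length (f x ∷ Y₂) ≡⟨ length-++ Y₁ ⟨
  length (Y₁ ++ f x ∷ Y₂)     ∎
  where
  open ≤-Reasoning
  skip : ∀ {z} Z₁ → z ∈ Z₁ ++ f x ∷ Y₂ → z ≢ f x → z ∈ Z₁ ++ Y₂
  skip []       (here z≡fx) z≢fx = ⊥-elim (z≢fx z≡fx)
  skip []       (there p)   _    = p
  skip (_ ∷ Z₁) (here p)    _    = here p
  skip (_ ∷ Z₁) (there p)   z≢fx = there (skip Z₁ p z≢fx)
  into′ : ∀ {z} → z ∈ X → f z ∈ Y₁ ++ Y₂
  into′ z∈X = skip Y₁ (into (there z∈X)) λ fz≡fx → All.lookup x∉X z∈X (inj (here refl) (there z∈X) (sym fz≡fx))

module _ {A B : Set} {n : ℕ} {L₁ : List A} {L₂ : List B} {P₁ : A → Bool} {P₂ : B → Bool}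
  {w₁ : A → Monomial n} {w₂ : B → Monomial n} {c : Monomial n}
  (U₁ : Unique L₁) (U₂ : Unique L₂) (f : A → B) (g : B → A)
  (f-fibre : ∀ {x} → x ∈ L₁ → InFibre P₁ w₁ c x → f x ∈ L₂ × InFibre P₂ w₂ c (f x) × g (f x) ≡ x)
  (g-fibre : ∀ {y} → y ∈ L₂ → InFibre P₂ w₂ c y → g y ∈ L₁ × InFibre P₁ w₁ c (g y) × f (g y) ≡ y)
  where

  private
    X = filter (inFibre? P₁ w₁ c) L₁
    Y = filter (inFibre? P₂ w₂ c) L₂

    f∈ : ∀ {x} → x ∈ X → f x ∈ Y
    f∈ x∈X with ∈-filter⁻ (inFibre? P₁ w₁ c) {xs = L₁} x∈X
    ... | x∈L , fib with f-fibre x∈L fib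
    ... | fx∈L , fib′ , _ = ∈-filter⁺ (inFibre? P₂ w₂ c) fx∈L fib′

    g∈ : ∀ {y} → y ∈ Y → g y ∈ X
    g∈ y∈Y with ∈-filter⁻ (inFibre? P₂ w₂ c) {xs = L₂} y∈Y
    ... | y∈L , fib with g-fibre y∈L fib
    ... | gy∈L , fib′ , _ = ∈-filter⁺ (inFibre? P₁ w₁ c) gy∈L fib′

    gf : ∀ {x} → x ∈ X → g (f x) ≡ x
    gf x∈X = let (x∈L , fib) = ∈-filter⁻ (inFibre? P₁ w₁ c) {xs = L₁} x∈X in proj₂ (proj₂ (f-fibre x∈L fib))

    fg : ∀ {y} → y ∈ Y → f (g y) ≡ y
    fg y∈Y = let (y∈L , fib) = ∈-filter⁻ (inFibre? P₂ w₂ c) {xs = L₂} y∈Y in proj₂ (proj₂ (g-fibre y∈L fib))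

  coeff-≡-by-fibre-bijection : coeff (map w₁ (filterᵇ P₁ L₁)) c ≡ coeff (map w₂ (filterᵇ P₂ L₂)) c
  coeff-≡-by-fibre-bijection = begin
    coeff (map w₁ (filterᵇ P₁ L₁)) c ≡⟨ coeff-map-filterᵇ P₁ w₁ c L₁ ⟩
    length X                         ≡⟨ ≤-antisym X≤Y Y≤X ⟩
    length Y                         ≡⟨ coeff-map-filterᵇ P₂ w₂ c L₂ ⟨
    coeff (map w₂ (filterᵇ P₂ L₂)) c ∎
    where
    open ≡-Reasoning
    X≤Y = length-≤-of-injection Y (Unique.filter⁺ _ U₁) f f∈ λ p q e → trans (sym (gf p)) (trans (cong g e) (gf q))
    Y≤X = length-≤-of-injection X (Unique.filter⁺ _ U₂) g g∈ λ p q e → trans (sym (fg p)) (trans (cong f e) (fg q))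

∈⇒0<coeff : ∀ {n} {p : Poly n} {c} → c ∈ p → 0 < coeff p c
∈⇒0<coeff c∈p = ∈-length (∈-filter⁺ (λ m → ≡-dec _≟ℕ_ m _) c∈p refl)

0<coeff⇒∈ : ∀ {n} (p : Poly n) {c} → 0 < coeff p c → c ∈ p
0<coeff⇒∈ p {c} pos with filter (λ m → ≡-dec _≟ℕ_ m c) p in eq
... | m ∷ _ with ∈-filter⁻ (λ m → ≡-dec _≟ℕ_ m c) {xs = p} (subst (m ∈_) (sym eq) (here refl))
...   | m∈p , refl = m∈p

∈-resp-≈ₚ : ∀ {n} {p q : Poly n} {c} → p ≈ₚ q → c ∈ p → c ∈ q
∈-resp-≈ₚ {q = q} {c} p≈q c∈p = 0<coeff⇒∈ q (subst (0 <_) (p≈q c) (∈⇒0<coeff c∈p))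

coeff-reverseVars : ∀ {n} (p : Poly n) c → coeff (reverseVars p) c ≡ coeff p (Vec.reverse c)
coeff-reverseVars [] c = refl
coeff-reverseVars (m ∷ p) c = step (≡-dec _≟ℕ_ (Vec.reverse m) c) (≡-dec _≟ℕ_ m (Vec.reverse c))
  where
  rest = coeff-reverseVars p c
  step : Dec (Vec.reverse m ≡ c) → Dec (m ≡ Vec.reverse c) → coeff (reverseVars (m ∷ p)) c ≡ coeff (m ∷ p) (Vec.reverse c)
  step (yes r) (yes e) = trans (cong length (filter-accept (λ x → ≡-dec _≟ℕ_ x c) r))
    (trans (cong suc rest) (sym (cong length (filter-accept (λ x → ≡-dec _≟ℕ_ x (Vec.reverse c)) e))))
  step (no ¬r) (no ¬e) = trans (cong length (filter-reject (λ x → ≡-dec _≟ℕ_ x c) ¬r))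
    (trans rest (sym (cong length (filter-reject (λ x → ≡-dec _≟ℕ_ x (Vec.reverse c)) ¬e))))
  step (yes r) (no ¬e) = ⊥-elim (¬e (sym (Vec.reverse-reverse r)))
  step (no ¬r) (yes e) = ⊥-elim (¬r (Vec.reverse-reverse (sym e)))

reverseVars-cong : ∀ {n} {p q : Poly n} → p ≈ₚ q → reverseVars p ≈ₚ reverseVars q
reverseVars-cong {p = p} {q} p≈q c = begin
  coeff (reverseVars p) c ≡⟨ coeff-reverseVars p c ⟩
  coeff p (Vec.reverse c) ≡⟨ p≈q (Vec.reverse c) ⟩
  coeff q (Vec.reverse c) ≡⟨ coeff-reverseVars q c ⟨
  coeff (reverseVars q) c ∎
  where open ≡-Reasoning

-- Enumerations

module _ {A : Set} (L : List (List A)) where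

  prepends : List A → List (List A)
  prepends = concatMap (λ e → map (e ∷_) L)

  ∈-prepends⁻ : ∀ es {z} → z ∈ prepends es → ∃[ e ] ∃[ t ] (e ∈ es × t ∈ L × z ≡ e ∷ t)
  ∈-prepends⁻ (e ∷ es) z∈ with ∈-++⁻ (map (e ∷_) L) z∈
  ... | inj₁ z∈e∷L with ∈-map⁻ (e ∷_) z∈e∷L
  ...   | t , t∈L , refl = e , t , here refl , t∈L , refl
  ∈-prepends⁻ (e ∷ es) z∈ | inj₂ z∈rest with ∈-prepends⁻ es z∈rest
  ...   | e′ , t , e′∈es , t∈L , eq = e′ , t , there e′∈es , t∈L , eq

  ∈-prepends⁺ : ∀ es {e t} → e ∈ es → t ∈ L → e ∷ t ∈ prepends es
  ∈-prepends⁺ (e ∷ es) (here refl) t∈L = ∈-++⁺ˡ (∈-map⁺ (e ∷_) t∈L)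
  ∈-prepends⁺ (e ∷ es) (there e∈es) t∈L = ∈-++⁺ʳ (map (e ∷_) L) (∈-prepends⁺ es e∈es t∈L)

  prepends-unique : ∀ {es} → Unique es → Unique L → Unique (prepends es)
  prepends-unique {[]} _ _ = []
  prepends-unique {e ∷ es} (e∉es ∷ ues) uL =
    Unique.++⁺ (Unique.map⁺ (proj₂ ∘ ∷-injective) uL) (prepends-unique ues uL) disjoint
    where
    disjoint : ∀ {v} → ¬ (v ∈ map (e ∷_) L × v ∈ prepends es)
    disjoint (p , q) with ∈-map⁻ (e ∷_) p | ∈-prepends⁻ es q
    ... | _ , _ , refl | _ , _ , e∈es , _ , refl = All.lookup e∉es e∈es refl

InRange : ℕ → ℕ → Set
InRange m e = 1 ≤ e × e ≤ m

InRange-mono : ∀ {m m′ e} → m ≤ m′ → InRange m e → InRange m′ e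
InRange-mono m≤m′ (1≤e , e≤m) = 1≤e , ≤-trans e≤m m≤m′

∈-lists⁻ : ∀ k m {xs} → xs ∈ lists k m → length xs ≡ k × All (InRange m) xs
∈-lists⁻ zero    m (here refl) = refl , []
∈-lists⁻ (suc k) m p with ∈-prepends⁻ (lists k m) (map suc (upTo m)) p
... | e , t , e∈ , t∈ , refl with ∈-map⁻ suc e∈ | ∈-lists⁻ k m t∈
...   | e′ , e′∈ , refl | len , bounded = cong suc len , (s≤s z≤n , ∈-upTo⁻ e′∈) ∷ bounded

∈-lists⁺ : ∀ k m {xs} → length xs ≡ k → All (InRange m) xs → xs ∈ lists k m
∈-lists⁺ zero    m {[]}         refl []                  = here refl
∈-lists⁺ (suc k) m {suc x ∷ xs} len  ((_ , x<m) ∷ bounded) =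
  ∈-prepends⁺ (lists k m) (map suc (upTo m)) (∈-map⁺ suc (∈-upTo⁺ x<m)) (∈-lists⁺ k m (suc-injective len) bounded)

lists-unique : ∀ k m → Unique (lists k m)
lists-unique zero    m = [] ∷ []
lists-unique (suc k) m = prepends-unique (lists k m) (Unique.map⁺ suc-injective (Unique.upTo⁺ m)) (lists-unique k m)

product-unique : ∀ {A : Set} {Ls : List (List A)} → All Unique Ls → Unique (product Ls)
product-unique []        = [] ∷ []
product-unique (u ∷ us) = prepends-unique _ u (product-unique us)

RowsBounded : ℕ → List (List ℕ) → Set
RowsBounded i []      = ⊤
RowsBounded i (r ∷ X) = All (InRange i) r × RowsBounded (suc i) X

∈-rowCandidates⁻ : ∀ i ks {X} → X ∈ product (rowCandidates i ks) → map length X ≡ ks × RowsBounded i X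
∈-rowCandidates⁻ i []       (here refl) = refl , tt
∈-rowCandidates⁻ i (k ∷ ks) p with ∈-prepends⁻ (product (rowCandidates (suc i) ks)) (lists k i) p
... | r , X , r∈ , X∈ , refl with ∈-lists⁻ k i r∈ | ∈-rowCandidates⁻ (suc i) ks X∈
...   | |r| , r-inRange | lengths , bounded = cong₂ _∷_ |r| lengths , r-inRange , bounded

∈-rowCandidates⁺ : ∀ i X → RowsBounded i X → X ∈ product (rowCandidates i (map length X))
∈-rowCandidates⁺ i []      tt                   = here refl
∈-rowCandidates⁺ i (r ∷ X) (r-inRange , bounded) =
  ∈-prepends⁺ (product (rowCandidates (suc i) (map length X))) (lists (length r) i)
    (∈-lists⁺ (length r) i refl r-inRange) (∈-rowCandidates⁺ (suc i) X bounded)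

candidates-unique : ∀ {n} (a : Vec ℕ n) → Unique (candidates a)
candidates-unique a = product-unique (rows 1 (toList a))
  where
  rows : ∀ i ks → All Unique (rowCandidates i ks)
  rows i []       = []
  rows i (k ∷ ks) = lists-unique k i ∷ rows (suc i) ks

-- Boolean conditions as relations

module _ (check : List ℕ → Bool) (r : ℕ → ℕ → Bool) {R : ℕ → ℕ → Set}
  (T-r : ∀ {x y} → T (r x y) ⇔ R x y) (R-trans : Transitive R)
  (check-[] : T (check [])) (check-[-] : ∀ x → T (check [ x ]))
  (check-∷ : ∀ x y xs → check (x ∷ y ∷ xs) ≡ r x y ∧ check (y ∷ xs))
  where

  T-linked : ∀ {xs} → T (check xs) ⇔ AllPairs R xs
  T-linked = mk⇔ (Linked⇒AllPairs R-trans ∘ to) (from ∘ AllPairs⇒Linked)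
    where
    to : ∀ {xs} → T (check xs) → Linked R xs
    to {[]}         _ = []
    to {x ∷ []}     _ = [-]
    to {x ∷ y ∷ xs} p =
      let (rxy , rest) = Equivalence.to T-∧ (subst T (check-∷ x y xs) p) in Equivalence.to T-r rxy ∷ to rest
    from : ∀ {xs} → Linked R xs → T (check xs)
    from []                          = check-[]
    from [-]                         = check-[-] _
    from {x ∷ y ∷ xs} (Rxy ∷ linked) =
      subst T (sym (check-∷ x y xs)) (Equivalence.from T-∧ (Equivalence.from T-r Rxy , from linked))

Sorted≤ Sorted≥ Sorted< : List ℕ → Set
Sorted≤ = AllPairs _≤_
Sorted≥ = AllPairs _≥_
Sorted< = AllPairs _<_

T-weaklyIncreasing : ∀ {xs} → T (weaklyIncreasing xs) ⇔ Sorted≤ xs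
T-weaklyIncreasing = T-linked weaklyIncreasing _≤ᵇ_ (mk⇔ (≤ᵇ⇒≤ _ _) ≤⇒≤ᵇ) ≤-trans _ _ λ _ _ _ → refl

T-weaklyDecreasing : ∀ {xs} → T (weaklyDecreasing xs) ⇔ Sorted≥ xs
T-weaklyDecreasing =
  T-linked weaklyDecreasing (λ x y → y ≤ᵇ x) (mk⇔ (≤ᵇ⇒≤ _ _) ≤⇒≤ᵇ) (λ x≥y y≥z → ≤-trans y≥z x≥y) _ _ λ _ _ _ → refl

T-strictlyIncreasing : ∀ {xs} → T (strictlyIncreasing xs) ⇔ Sorted< xs
T-strictlyIncreasing = T-linked strictlyIncreasing _<ᵇ_ (mk⇔ (<ᵇ⇒< _ _) <⇒<ᵇ) <-trans _ _ λ _ _ _ → refl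

infix 4 _≪_
_≪_ : List ℕ → List ℕ → Set
r ≪ s = All (λ x → All (x <_) s) r

T-allSmaller : ∀ {r s} → T (allSmaller r s) ⇔ r ≪ s
T-allSmaller {r} {s} = mk⇔
  (λ p → All.map (λ {x} q → All.map (<ᵇ⇒< x _) (All.all⁺ _ s q)) (All.all⁺ _ r p))
  (λ p → All.all⁻ _ (All.map (λ q → All.all⁻ _ (All.map <⇒<ᵇ q)) p))

T-rowsSeparated : ∀ {X} → T (rowsSeparated X) ⇔ AllPairs _≪_ X
T-rowsSeparated = mk⇔ to from
  where
  to : ∀ {X} → T (rowsSeparated X) → AllPairs _≪_ X
  to {[]}    _ = []
  to {r ∷ X} p = let (below , rest) = Equivalence.to T-∧ p in All.map (Equivalence.to T-allSmaller) (All.all⁺ _ X below) ∷ to rest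
  from : ∀ {X} → AllPairs _≪_ X → T (rowsSeparated X)
  from []             = _
  from (below ∷ rest) = Equivalence.from T-∧ (All.all⁻ _ (All.map (Equivalence.from T-allSmaller) below) , from rest)

FundFilling : List (List ℕ) → Set
FundFilling X = All Sorted≥ X × AllPairs _≪_ X

T-isFundFilling : ∀ {X} → T (isFundFilling X) ⇔ FundFilling X
T-isFundFilling {X} = mk⇔
  (λ p → let (rows , sep) = Equivalence.to T-∧ p
         in All.map (Equivalence.to T-weaklyDecreasing) (All.all⁺ _ X rows) , Equivalence.to T-rowsSeparated sep)
  (λ (rows , sep) → Equivalence.from T-∧
    (All.all⁻ _ (All.map (Equivalence.from T-weaklyDecreasing) rows) , Equivalence.from T-rowsSeparated sep))

Constant : List ℕ → Set
Constant []       = ⊤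
Constant (x ∷ xs) = All (_≡ x) xs

T-constantRow : ∀ {r} → T (constantRow r) ⇔ Constant r
T-constantRow {[]}     = mk⇔ _ _
T-constantRow {x ∷ xs} = mk⇔
  (λ p → All.map (≡ᵇ⇒≡ _ x) (All.all⁺ _ xs p))
  (λ p → All.all⁻ _ (All.map (≡⇒≡ᵇ _ x) p))

MonFilling : List (List ℕ) → Set
MonFilling X = FundFilling X × All Constant X

T-isMonFilling : ∀ {X} → T (isMonFilling X) ⇔ MonFilling X
T-isMonFilling {X} = mk⇔
  (λ p → let (fund , const) = Equivalence.to T-∧ p
         in Equivalence.to T-isFundFilling fund , All.map (Equivalence.to T-constantRow) (All.all⁺ _ X const))
  (λ (fund , const) → Equivalence.from T-∧
    (Equivalence.from T-isFundFilling fund , All.all⁻ _ (All.map (Equivalence.from T-constantRow) const)))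

-- Letter counts and monomials of words

≡ᵇ-true : ∀ {m n} → m ≡ n → (m ≡ᵇ n) ≡ true
≡ᵇ-true {m} {n} m≡n = Equivalence.to T-≡ (≡⇒≡ᵇ m n m≡n)

≡ᵇ-false : ∀ {m n} → m ≢ n → (m ≡ᵇ n) ≡ false
≡ᵇ-false {m} {n} m≢n with m ≡ᵇ n in eq
... | false = refl
... | true  = ⊥-elim (m≢n (≡ᵇ⇒≡ m n (subst T (sym eq) tt)))

countℕ-here : ∀ k X → countℕ k (k ∷ X) ≡ suc (countℕ k X)
countℕ-here k X = cong length (filter-accept (λ y → T? (y ≡ᵇ k)) {x = k} {xs = X} (≡⇒≡ᵇ k k refl))

countℕ-skip : ∀ {x k} X → x ≢ k → countℕ k (x ∷ X) ≡ countℕ k X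
countℕ-skip {x} {k} X x≢k = cong length (filter-reject (λ y → T? (y ≡ᵇ k)) {x = x} {xs = X} (x≢k ∘ ≡ᵇ⇒≡ x k))

countℕ-++ : ∀ k xs ys → countℕ k (xs ++ ys) ≡ countℕ k xs + countℕ k ys
countℕ-++ k xs ys = trans (cong length (filter-++ (λ y → T? (y ≡ᵇ k)) xs ys)) (length-++ (filterᵇ (_≡ᵇ k) xs))

countℕ-↭ : ∀ k {xs ys} → xs ↭ ys → countℕ k xs ≡ countℕ k ys
countℕ-↭ k xs↭ys = ↭-length (filter-↭ (λ y → T? (y ≡ᵇ k)) xs↭ys)

countℕ-replicate : ∀ k a x → countℕ k (replicate a x) ≡ (if x ≡ᵇ k then a else 0)
countℕ-replicate k a x with x ≡ᵇ k in eq
... | true  = all a (≡ᵇ⇒≡ x k (subst T (sym eq) tt))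
  where
  all : ∀ a → x ≡ k → countℕ k (replicate a x) ≡ a
  all zero    _    = refl
  all (suc a) refl = trans (countℕ-here k (replicate a k)) (cong suc (all a refl))
... | false = none a (λ x≡k → subst T eq (≡⇒≡ᵇ x k x≡k))
  where
  none : ∀ a → x ≢ k → countℕ k (replicate a x) ≡ 0
  none zero    _   = refl
  none (suc a) x≢k = trans (countℕ-skip (replicate a x) x≢k) (none a x≢k)

countℕ-map : ∀ (f : ℕ → ℕ) k k′ {X} → All (λ x → f x ≡ k ⇔ x ≡ k′) X → countℕ k (map f X) ≡ countℕ k′ X
countℕ-map f k k′ {[]}    []            = refl
countℕ-map f k k′ {x ∷ X} (fx⇔x ∷ rest) with f x ≟ℕ k
... | yes fx≡k = begin
  countℕ k (f x ∷ map f X) ≡⟨ cong (λ y → countℕ k (y ∷ map f X)) fx≡k ⟩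
  countℕ k (k ∷ map f X)   ≡⟨ countℕ-here k (map f X) ⟩
  suc (countℕ k (map f X)) ≡⟨ cong suc (countℕ-map f k k′ rest) ⟩
  suc (countℕ k′ X)        ≡⟨ countℕ-here k′ X ⟨
  countℕ k′ (k′ ∷ X)       ≡⟨ cong (λ y → countℕ k′ (y ∷ X)) (Equivalence.to fx⇔x fx≡k) ⟨
  countℕ k′ (x ∷ X)        ∎
  where open ≡-Reasoning
... | no fx≢k =
  trans (countℕ-skip (map f X) fx≢k) (trans (countℕ-map f k k′ rest) (sym (countℕ-skip X (fx≢k ∘ Equivalence.from fx⇔x))))

countℕ≡0⇔ : ∀ k X → countℕ k X ≡ 0 ⇔ All (_≢ k) X
countℕ≡0⇔ k X = mk⇔ (to X) (from X)
  where
  to : ∀ X → countℕ k X ≡ 0 → All (_≢ k) X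
  to []      _ = []
  to (x ∷ X) c with x ≟ℕ k
  ... | yes refl with () ← trans (sym (countℕ-here k X)) c
  ... | no x≢k   = x≢k ∷ to X (trans (sym (countℕ-skip X x≢k)) c)
  from : ∀ X → All (_≢ k) X → countℕ k X ≡ 0
  from []      []           = refl
  from (x ∷ X) (x≢k ∷ rest) = trans (countℕ-skip X x≢k) (from X rest)

seqMonomial-↭ : ∀ n {xs ys} → xs ↭ ys → seqMonomial n xs ≡ seqMonomial n ys
seqMonomial-↭ n xs↭ys = Vec.tabulate-cong (λ i → countℕ-↭ (suc (toℕ i)) xs↭ys)

concat-map-reverse-↭ : ∀ (X : List (List ℕ)) → concat (map reverse X) ↭ concat X
concat-map-reverse-↭ []      = ↭-refl
concat-map-reverse-↭ (r ∷ X) = ++⁺ (↭-reverse r) (concat-map-reverse-↭ X)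

concat-reverse-↭ : ∀ (X : List (List ℕ)) → concat (reverse X) ↭ concat X
concat-reverse-↭ []      = ↭-refl
concat-reverse-↭ (r ∷ X) = begin
  concat (reverse (r ∷ X))        ≡⟨ cong concat (unfold-reverse r X) ⟩
  concat (reverse X ++ [ r ])     ≡⟨ concat-++ (reverse X) [ r ] ⟨
  concat (reverse X) ++ r ++ []   ↭⟨ ++⁺ (concat-reverse-↭ X) (↭-reflexive (++-identityʳ r)) ⟩
  concat X ++ r                   ↭⟨ ++-comm (concat X) r ⟩
  r ++ concat X                   ∎
  where open PermutationReasoning

toList-seqMonomial : ∀ n X → toList (seqMonomial n X) ≡ applyUpTo (λ m → countℕ (suc m) X) n
toList-seqMonomial n X = toList-tabulate n (λ m → countℕ (suc m) X)
  where
  toList-tabulate : ∀ n (h : ℕ → ℕ) → toList (Vec.tabulate {n = n} (h ∘ toℕ)) ≡ applyUpTo h n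
  toList-tabulate zero    h = refl
  toList-tabulate (suc n) h = cong (h 0 ∷_) (toList-tabulate n (h ∘ suc))

applyUpTo-cong< : ∀ n {f g : ℕ → ℕ} → (∀ m → m < n → f m ≡ g m) → applyUpTo f n ≡ applyUpTo g n
applyUpTo-cong< zero    f≡g = refl
applyUpTo-cong< (suc n) f≡g = cong₂ _∷_ (f≡g 0 z<s) (applyUpTo-cong< n (λ m m<n → f≡g (suc m) (s<s m<n)))

reverse-applyUpTo′ : ∀ (h : ℕ → ℕ) n → reverse (applyUpTo h n) ≡ applyUpTo (λ m → h (n ∸ suc m)) n
reverse-applyUpTo′ h n = trans (reverse-applyUpTo h n) (downFrom n)
  where
  downFrom : ∀ n → applyDownFrom h n ≡ applyUpTo (λ m → h (n ∸ suc m)) n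
  downFrom zero    = refl
  downFrom (suc n) = cong (h n ∷_) (downFrom n)

mirror : ℕ → ℕ → ℕ
mirror n e = suc n ∸ e

mirror-InRange : ∀ n {e} → InRange n e → InRange n (mirror n e)
mirror-InRange n (1≤e , e≤n) = m<n⇒0<n∸m (s≤s e≤n) , ∸-monoʳ-≤ (suc n) 1≤e

mirror-involutive : ∀ n {e} → InRange n e → mirror n (mirror n e) ≡ e
mirror-involutive n (_ , e≤n) = m∸[m∸n]≡n (≤-trans e≤n (n≤1+n n))

mirror-≤ : ∀ n {x y} → x ≤ y → mirror n y ≤ mirror n x
mirror-≤ n x≤y = ∸-monoʳ-≤ (suc n) x≤y

mirror-< : ∀ n {x y} → InRange n y → x < y → mirror n y < mirror n x
mirror-< n (_ , y≤n) x<y = ∸-monoʳ-< x<y (≤-trans y≤n (n≤1+n n))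

toList-injective : ∀ {n} {u v : Vec ℕ n} → toList u ≡ toList v → u ≡ v
toList-injective {u = u} {v} eq = trans (sym (Vec.cast-is-id refl u)) (Vec.toList-injective refl u v eq)

seqMonomial-mirror : ∀ n X → All (InRange n) X → seqMonomial n (map (mirror n) X) ≡ Vec.reverse (seqMonomial n X)
seqMonomial-mirror n X inRange = toList-injective (begin
  toList (seqMonomial n (map (mirror n) X))             ≡⟨ toList-seqMonomial n (map (mirror n) X) ⟩
  applyUpTo (λ m → countℕ (suc m) (map (mirror n) X)) n ≡⟨ applyUpTo-cong< n (λ m m<n → countℕ-map (mirror n) _ _ (All.map (mirror≡ m<n) inRange)) ⟩
  applyUpTo (λ m → countℕ (n ∸ m) X) n                  ≡⟨ applyUpTo-cong< n (λ m m<n → cong (λ k → countℕ k X) (+-∸-assoc 1 m<n)) ⟩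
  applyUpTo (λ m → countℕ (suc (n ∸ suc m)) X) n        ≡⟨ reverse-applyUpTo′ (λ m → countℕ (suc m) X) n ⟨
  reverse (applyUpTo (λ m → countℕ (suc m) X) n)       ≡⟨ cong reverse (toList-seqMonomial n X) ⟨
  reverse (toList (seqMonomial n X))                   ≡⟨ Vec.toList-reverse (seqMonomial n X) ⟨
  toList (Vec.reverse (seqMonomial n X))               ∎)
  where
  open ≡-Reasoning
  mirror≡ : ∀ {m e} → m < n → InRange n e → mirror n e ≡ suc m ⇔ e ≡ n ∸ m
  mirror≡ {m} {e} m<n (_ , e≤n) = mk⇔
    (λ eq → trans (sym (m∸[m∸n]≡n e≤n)) (cong (n ∸_) (suc-injective (trans (sym (+-∸-assoc 1 e≤n)) eq))))
    (λ { refl → trans (+-∸-assoc 1 (m∸n≤m n m)) (cong suc (m∸[m∸n]≡n (<⇒≤ m<n))) })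

constantRows : List ℕ → List ℕ → List (List ℕ)
constantRows (a ∷ α) (i ∷ is) = replicate a i ∷ constantRows α is
constantRows _       _        = []

-- The summand of expMonomial is local to its where-block in Defs, so it is reached only through lookup∘tabulate.
expMonomial≡seqMonomial : ∀ n α is → expMonomial n α is ≡ seqMonomial n (concat (constantRows α is))
expMonomial≡seqMonomial n α is = trans (sym (Vec.tabulate∘lookup (expMonomial n α is))) (Vec.tabulate-cong (entry α is))
  where
  entry : ∀ α is k → Vec.lookup (expMonomial n α is) k ≡ countℕ (suc (toℕ k)) (concat (constantRows α is))
  entry []      is       k = Vec.lookup∘tabulate _ k
  entry (a ∷ α) []       k = Vec.lookup∘tabulate _ k
  entry (a ∷ α) (i ∷ is) k = trans (Vec.lookup∘tabulate _ k) (begin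
    (if i ≡ᵇ suc (toℕ k) then a else 0) + _
      ≡⟨ cong₂ _+_ (sym (countℕ-replicate (suc (toℕ k)) a i)) (trans (sym (Vec.lookup∘tabulate _ k)) (entry α is k)) ⟩
    countℕ (suc (toℕ k)) (replicate a i) + countℕ (suc (toℕ k)) (concat (constantRows α is))
      ≡⟨ countℕ-++ (suc (toℕ k)) (replicate a i) _ ⟨
    countℕ (suc (toℕ k)) (concat (constantRows (a ∷ α) (i ∷ is))) ∎)
    where open ≡-Reasoning

-- Descent sets and blocks

cutsFrom : ℕ → List ℕ → List ℕ
cutsFrom e []      = []
cutsFrom e (b ∷ β) = e ∷ cutsFrom (e + b) β

partialSumsFrom-∷ : ∀ s a β → partialSumsFrom s (a ∷ β) ≡ cutsFrom (s + a) β
partialSumsFrom-∷ s a []      = refl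
partialSumsFrom-∷ s a (b ∷ β) = cong (s + a ∷_) (partialSumsFrom-∷ (s + a) b β)

memberᵇ-cutsFrom-< : ∀ {j} e β → j < e → memberᵇ j (cutsFrom e β) ≡ false
memberᵇ-cutsFrom-< e []      j<e = refl
memberᵇ-cutsFrom-< e (b ∷ β) j<e rewrite ≡ᵇ-false (<⇒≢ j<e ∘ sym) = memberᵇ-cutsFrom-< (e + b) β (<-≤-trans j<e (m≤m+n e b))

fundSeqOk-cong : ∀ S S′ j s → (∀ p → j ≤ p → memberᵇ p S ≡ memberᵇ p S′) → fundSeqOk S j s ≡ fundSeqOk S′ j s
fundSeqOk-cong S S′ j []           _    = refl
fundSeqOk-cong S S′ j (x ∷ [])     _    = refl
fundSeqOk-cong S S′ j (x ∷ y ∷ xs) S≗S′ = cong₂ _∧_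
  (cong (λ b → if b then x <ᵇ y else x ≤ᵇ y) (S≗S′ j ≤-refl))
  (fundSeqOk-cong S S′ (suc j) (y ∷ xs) (λ p j<p → S≗S′ p (<⇒≤ j<p)))

first final : List ℕ → ℕ
first []      = 0
first (x ∷ _) = x
final []           = 0
final (x ∷ [])     = x
final (_ ∷ y ∷ xs) = final (y ∷ xs)

blocksOk : List ℕ → List (List ℕ) → Bool
blocksOk B []       = weaklyIncreasing B
blocksOk B (C ∷ Bs) = weaklyIncreasing B ∧ ((final B <ᵇ first C) ∧ blocksOk C Bs)

NonEmpty : List ℕ → Set
NonEmpty []      = ⊥
NonEmpty (_ ∷ _) = ⊤

-- The block x ∷ B starts at position j of the word and ends at position e.
fundSeqOk-blocks : ∀ x B Bs j e → j + length B ≡ e → All NonEmpty Bs →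
  fundSeqOk (cutsFrom e (map length Bs)) j (concat ((x ∷ B) ∷ Bs)) ≡ blocksOk (x ∷ B) Bs
fundSeqOk-blocks x (x′ ∷ B) Bs j e j+|B|≡e nonEmpty
  rewrite memberᵇ-cutsFrom-< e (map length Bs) (subst (j <_) j+|B|≡e (m<m+n j z<s)) =
  trans (cong ((x ≤ᵇ x′) ∧_) (fundSeqOk-blocks x′ B Bs (suc j) e (trans (sym (+-suc j (length B))) j+|B|≡e) nonEmpty))
        (sym (assoc Bs))
  where
  assoc : ∀ Bs → blocksOk (x ∷ x′ ∷ B) Bs ≡ (x ≤ᵇ x′) ∧ blocksOk (x′ ∷ B) Bs
  assoc []       = refl
  assoc (C ∷ Bs) = ∧-assoc (x ≤ᵇ x′) (weaklyIncreasing (x′ ∷ B)) _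
fundSeqOk-blocks x [] [] j e _ _ = refl
fundSeqOk-blocks x [] ((y ∷ C) ∷ Bs) j e refl (_ ∷ nonEmpty)
  rewrite +-identityʳ j | ≡ᵇ-true {j} refl =
  cong ((x <ᵇ y) ∧_) (trans
    (fundSeqOk-cong (j ∷ cuts) cuts (suc j) (concat ((y ∷ C) ∷ Bs))
      (λ p j<p → cong (λ b → b ∨ memberᵇ p cuts) (≡ᵇ-false (<⇒≢ j<p))))
    (fundSeqOk-blocks y C Bs (suc j) (j + suc (length C)) (sym (+-suc j (length C))) nonEmpty))
  where
  cuts = cutsFrom (j + suc (length C)) (map length Bs)

StrongChain : List (List ℕ) → Set
StrongChain Bs = All Sorted≤ Bs × AllPairs _≪_ Bs

first∈ : ∀ {B} → NonEmpty B → first B ∈ B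
first∈ {x ∷ B} _ = here refl

final∈ : ∀ {B} → NonEmpty B → final B ∈ B
final∈ {x ∷ []}     _ = here refl
final∈ {x ∷ y ∷ B} _ = there (final∈ {y ∷ B} tt)

first-≤ : ∀ {B x} → Sorted≤ B → x ∈ B → first B ≤ x
first-≤ _               (here refl) = ≤-refl
first-≤ (first≤B ∷ _) (there x∈B) = All.lookup first≤B x∈B

≤-final : ∀ {B x} → Sorted≤ B → x ∈ B → x ≤ final B
≤-final {x ∷ []}    _               (here refl) = ≤-refl
≤-final {x ∷ y ∷ B} (x≤B ∷ sorted) (here refl) = ≤-trans (All.head x≤B) (≤-final sorted (here refl))
≤-final {x ∷ y ∷ B} (_ ∷ sorted)   (there x∈B) = ≤-final sorted x∈B

T-blocksOk : ∀ {B} Bs → NonEmpty B → All NonEmpty Bs → T (blocksOk B Bs) ⇔ StrongChain (B ∷ Bs)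
T-blocksOk {B} [] _ _ = mk⇔
  (λ p → Equivalence.to T-weaklyIncreasing p ∷ [] , [] ∷ [])
  (λ (sorted , _) → Equivalence.from T-weaklyIncreasing (All.head sorted))
T-blocksOk {B} (C ∷ Bs) neB (neC ∷ neBs) = mk⇔ to from
  where
  to : T (blocksOk B (C ∷ Bs)) → StrongChain (B ∷ C ∷ Bs)
  to p =
    let (incB , q)    = Equivalence.to T-∧ p
        (gap , rest)  = Equivalence.to T-∧ q
        sortedB       = Equivalence.to T-weaklyIncreasing incB
        final<first   = <ᵇ⇒< (final B) (first C) gap
        (sorted , sep) = Equivalence.to (T-blocksOk Bs neC neBs) rest
        sortedC       = All.head sorted
        firstC≤       : ∀ {D} → All (first C ≤_) D → B ≪ D
        firstC≤ below = All.tabulate (λ x∈B → All.map (<-≤-trans (≤-<-trans (≤-final sortedB x∈B) final<first)) below)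
        firstC≤C      = All.tabulate (first-≤ sortedC)
        firstC≤Bs     = All.map (λ C≪D → All.map <⇒≤ (All.lookup C≪D (first∈ neC))) (AllPairs.head sep)
    in sortedB ∷ sorted , (firstC≤ firstC≤C ∷ All.map firstC≤ firstC≤Bs) ∷ sep
  from : StrongChain (B ∷ C ∷ Bs) → T (blocksOk B (C ∷ Bs))
  from (sortedB ∷ sorted , (B≪C ∷ _) ∷ sep) = Equivalence.from T-∧
    ( Equivalence.from T-weaklyIncreasing sortedB
    , Equivalence.from T-∧ (<⇒<ᵇ (All.lookup (All.lookup B≪C (final∈ neB)) (first∈ neC))
                           , Equivalence.from (T-blocksOk Bs neC neBs) (sorted , sep)))

T-fundSeqOk-concat : ∀ Bs → All NonEmpty Bs → T (fundSeqOk (descentSet (map length Bs)) 1 (concat Bs)) ⇔ StrongChain Bs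
T-fundSeqOk-concat []             _               = mk⇔ (λ _ → [] , []) _
T-fundSeqOk-concat ((x ∷ B) ∷ Bs) (neB ∷ neBs) rewrite partialSumsFrom-∷ 0 (suc (length B)) (map length Bs)
                                                   | fundSeqOk-blocks x B Bs 1 (suc (length B)) refl neBs =
  T-blocksOk Bs neB neBs

chop : List ℕ → List ℕ → List (List ℕ)
chop []      s = []
chop (a ∷ α) s = take a s ∷ chop α (drop a s)

chop-concat : ∀ Bs → chop (map length Bs) (concat Bs) ≡ Bs
chop-concat []       = refl
chop-concat (B ∷ Bs) = cong₂ _∷_ (take-prefix B) (trans (cong (chop (map length Bs)) (drop-prefix B)) (chop-concat Bs))
  where
  take-prefix : ∀ B → take (length B) (B ++ concat Bs) ≡ B
  take-prefix []      = refl
  take-prefix (b ∷ B) = cong (b ∷_) (take-prefix B)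
  drop-prefix : ∀ B → drop (length B) (B ++ concat Bs) ≡ concat Bs
  drop-prefix []      = refl
  drop-prefix (b ∷ B) = drop-prefix B

length-take-+ : ∀ a m (s : List ℕ) → length s ≡ a + m → length (take a s) ≡ a
length-take-+ zero    m s       eq = refl
length-take-+ (suc a) m (_ ∷ s) eq = cong suc (length-take-+ a m s (suc-injective eq))

length-drop-+ : ∀ a m (s : List ℕ) → length s ≡ a + m → length (drop a s) ≡ m
length-drop-+ zero    m s       eq = eq
length-drop-+ (suc a) m (_ ∷ s) eq = length-drop-+ a m s (suc-injective eq)

concat-chop : ∀ α s → length s ≡ sum α → concat (chop α s) ≡ s
concat-chop []      []  refl = refl
concat-chop (a ∷ α) s   eq   =
  trans (cong (take a s ++_) (concat-chop α (drop a s) (length-drop-+ a (sum α) s eq))) (take++drop≡id a s)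

map-length-chop : ∀ α s → length s ≡ sum α → map length (chop α s) ≡ α
map-length-chop []      s eq = refl
map-length-chop (a ∷ α) s eq = cong₂ _∷_ (length-take-+ a (sum α) s eq) (map-length-chop α (drop a s) (length-drop-+ a (sum α) s eq))

-- Reversal and mirroring

All-reverse⁺ : ∀ {A : Set} {P : A → Set} {xs} → All P xs → All P (reverse xs)
All-reverse⁺ p = All.tabulate (All.lookup p ∘ ∈-reverse⁻)

AllPairs-reverse⁺ : ∀ {A : Set} {R : A → A → Set} {xs} → AllPairs R xs → AllPairs (flip R) (reverse xs)
AllPairs-reverse⁺ {xs = []}               []           = []
AllPairs-reverse⁺ {R = R} {xs = x ∷ xs} (x≺xs ∷ rest) = subst (AllPairs (flip R)) (sym (unfold-reverse x xs))
  (AllPairs.++⁺ (AllPairs-reverse⁺ rest) ([] ∷ []) (All.map (_∷ []) (All.tabulate (All.lookup x≺xs ∘ ∈-reverse⁻))))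

AllPairs-map-resp : ∀ {A B : Set} {P : A → Set} {R : A → A → Set} {S : B → B → Set} (f : A → B) {xs} → All P xs →
  (∀ {x y} → P x → P y → R x y → S (f x) (f y)) → AllPairs R xs → AllPairs S (map f xs)
AllPairs-map-resp f {[]}     []       resp []            = []
AllPairs-map-resp f {x ∷ xs} (px ∷ ps) resp (x≺xs ∷ rest) =
  All.map⁺ (All.zipWith (λ (py , r) → resp px py r) (ps , x≺xs)) ∷ AllPairs-map-resp f ps resp rest

≪-reverse : ∀ {r s} → r ≪ s → reverse r ≪ reverse s
≪-reverse r≪s = All-reverse⁺ (All.map All-reverse⁺ r≪s)

FundFilling⇒StrongChain : ∀ {X} → FundFilling X → StrongChain (map reverse X)
FundFilling⇒StrongChain (rows , sep) = All.map⁺ (All.map AllPairs-reverse⁺ rows) , AllPairs.map⁺ (AllPairs.map ≪-reverse sep)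

StrongChain⇒FundFilling : ∀ {Bs} → StrongChain Bs → FundFilling (map reverse Bs)
StrongChain⇒FundFilling (rows , sep) = All.map⁺ (All.map AllPairs-reverse⁺ rows) , AllPairs.map⁺ (AllPairs.map ≪-reverse sep)

mirrorWord : ℕ → List ℕ → List ℕ
mirrorWord n s = map (mirror n) (reverse s)

mirrorWord-InRange : ∀ n {s} → All (InRange n) s → All (InRange n) (mirrorWord n s)
mirrorWord-InRange n inRange = All.map⁺ (All.map (mirror-InRange n) (All-reverse⁺ inRange))

mirrorWord-involutive : ∀ n {s} → All (InRange n) s → mirrorWord n (mirrorWord n s) ≡ s
mirrorWord-involutive n {s} inRange = begin
  map (mirror n) (reverse (map (mirror n) (reverse s))) ≡⟨ cong (map (mirror n)) (reverse-map (mirror n) (reverse s)) ⟨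
  map (mirror n) (map (mirror n) (reverse (reverse s))) ≡⟨ cong (map (mirror n) ∘ map (mirror n)) (reverse-involutive s) ⟩
  map (mirror n) (map (mirror n) s)                     ≡⟨ map-∘ s ⟨
  map (mirror n ∘ mirror n) s                           ≡⟨ map-cong-All inRange ⟩
  s                                                     ∎
  where
  open ≡-Reasoning
  map-cong-All : ∀ {s} → All (InRange n) s → map (mirror n ∘ mirror n) s ≡ s
  map-cong-All []       = refl
  map-cong-All (e ∷ es) = cong₂ _∷_ (mirror-involutive n e) (map-cong-All es)

mirrorWord-Sorted≤ : ∀ n {s} → Sorted≤ s → Sorted≤ (mirrorWord n s)
mirrorWord-Sorted≤ n {s} sorted =
  AllPairs-map-resp (mirror n) (All.tabulate {xs = reverse s} (λ _ → tt)) (λ _ _ → mirror-≤ n) (AllPairs-reverse⁺ sorted)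

mirrorWord-Sorted< : ∀ n {s} → All (InRange n) s → Sorted< s → Sorted< (mirrorWord n s)
mirrorWord-Sorted< n inRange sorted =
  AllPairs-map-resp (mirror n) (All-reverse⁺ inRange) (λ py _ → mirror-< n py) (AllPairs-reverse⁺ sorted)

seqMonomial-mirrorWord : ∀ n {s} → All (InRange n) s → seqMonomial n (mirrorWord n s) ≡ Vec.reverse (seqMonomial n s)
seqMonomial-mirrorWord n {s} inRange =
  trans (seqMonomial-mirror n (reverse s) (All-reverse⁺ inRange)) (cong Vec.reverse (seqMonomial-↭ n (↭-reverse s)))

mirrorWord-≪ : ∀ n {r s} → All (InRange n) s → r ≪ s → mirrorWord n s ≪ mirrorWord n r
mirrorWord-≪ n s-inRange r≪s = All.map⁺ (All.tabulate λ {y} y∈rev-s →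
  All.map⁺ (All.tabulate λ x∈rev-r →
    mirror-< n (All.lookup s-inRange (∈-reverse⁻ y∈rev-s)) (All.lookup (All.lookup r≪s (∈-reverse⁻ x∈rev-r)) (∈-reverse⁻ y∈rev-s))))

mirrorBlocks : ℕ → List (List ℕ) → List (List ℕ)
mirrorBlocks n Bs = reverse (map (mirrorWord n) Bs)

concat-mirrorBlocks : ∀ n Bs → concat (mirrorBlocks n Bs) ≡ mirrorWord n (concat Bs)
concat-mirrorBlocks n []       = refl
concat-mirrorBlocks n (B ∷ Bs) = begin
  concat (mirrorBlocks n (B ∷ Bs))                                  ≡⟨ cong concat (unfold-reverse (mirrorWord n B) (map (mirrorWord n) Bs)) ⟩
  concat (reverse (map (mirrorWord n) Bs) ++ [ mirrorWord n B ])    ≡⟨ concat-++ (mirrorBlocks n Bs) [ mirrorWord n B ] ⟨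
  concat (mirrorBlocks n Bs) ++ mirrorWord n B ++ []                ≡⟨ cong₂ _++_ (concat-mirrorBlocks n Bs) (++-identityʳ _) ⟩
  map (mirror n) (reverse (concat Bs)) ++ map (mirror n) (reverse B) ≡⟨ map-++ (mirror n) (reverse (concat Bs)) (reverse B) ⟨
  map (mirror n) (reverse (concat Bs) ++ reverse B)                 ≡⟨ cong (map (mirror n)) (reverse-++ B (concat Bs)) ⟨
  mirrorWord n (B ++ concat Bs)                                     ∎
  where open ≡-Reasoning

map-length-mirrorBlocks : ∀ n Bs → map length (mirrorBlocks n Bs) ≡ reverse (map length Bs)
map-length-mirrorBlocks n Bs = begin
  map length (reverse (map (mirrorWord n) Bs)) ≡⟨ reverse-map length (map (mirrorWord n) Bs) ⟩
  reverse (map length (map (mirrorWord n) Bs)) ≡⟨ cong reverse (map-∘ Bs) ⟨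
  reverse (map (length ∘ mirrorWord n) Bs)     ≡⟨ cong reverse (map-cong (λ B → trans (length-map (mirror n) (reverse B)) (length-reverse B)) Bs) ⟩
  reverse (map length Bs)                      ∎
  where open ≡-Reasoning

StrongChain-mirrorBlocks : ∀ n {Bs} → All (All (InRange n)) Bs → StrongChain Bs → StrongChain (mirrorBlocks n Bs)
StrongChain-mirrorBlocks n inRange (sorted , sep) =
  All-reverse⁺ (All.map⁺ (All.map (mirrorWord-Sorted≤ n) sorted)) ,
  AllPairs-reverse⁺ (AllPairs-map-resp (mirrorWord n) inRange (λ _ C-inRange → mirrorWord-≪ n C-inRange) sep)

NonEmpty-lengths : ∀ {Bs} → All (0 <_) (map length Bs) → All NonEmpty Bs
NonEmpty-lengths {[]}          []       = []
NonEmpty-lengths {(_ ∷ _) ∷ _} (_ ∷ ps) = tt ∷ NonEmpty-lengths ps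

T-fundSeqOk⇔StrongChain : ∀ {β s} Bs → All (0 <_) β → map length Bs ≡ β → concat Bs ≡ s →
  T (fundSeqOk (descentSet β) 1 s) ⇔ StrongChain Bs
T-fundSeqOk⇔StrongChain Bs pos refl refl = T-fundSeqOk-concat Bs (NonEmpty-lengths pos)

fundSeqOk-mirrorWord : ∀ n β {s} → All (0 <_) β → length s ≡ sum β → All (InRange n) s →
  T (fundSeqOk (descentSet β) 1 s) → T (fundSeqOk (descentSet (reverse β)) 1 (mirrorWord n s))
fundSeqOk-mirrorWord n β {s} pos |s| inRange ok =
  Equivalence.from (T-fundSeqOk⇔StrongChain (mirrorBlocks n Bs) (All-reverse⁺ pos) lengths′ concat′)
    (StrongChain-mirrorBlocks n Bs-inRange (Equivalence.to (T-fundSeqOk⇔StrongChain Bs pos lengths concat-Bs) ok))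
  where
  Bs = chop β s
  lengths   = map-length-chop β s |s|
  concat-Bs = concat-chop β s |s|
  Bs-inRange = All.concat⁻ (subst (All (InRange n)) (sym concat-Bs) inRange)
  lengths′ = trans (map-length-mirrorBlocks n Bs) (cong reverse lengths)
  concat′  = trans (concat-mirrorBlocks n Bs) (cong (mirrorWord n) concat-Bs)

mirrorWord-∈-lists : ∀ n k {s} → s ∈ lists k n → mirrorWord n s ∈ lists k n
mirrorWord-∈-lists n k {s} s∈ =
  let (|s| , inRange) = ∈-lists⁻ k n s∈
  in ∈-lists⁺ k n (trans (length-map (mirror n) (reverse s)) (trans (length-reverse s) |s|)) (mirrorWord-InRange n inRange)

reverseVars-map : ∀ {A : Set} {n} (w : A → Monomial n) xs → reverseVars (map w xs) ≡ map (Vec.reverse ∘ w) xs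
reverseVars-map w xs = sym (map-∘ xs)

fundQSym-reverse : ∀ n α → All (0 <_) α → reverseVars (fundQSym n (reverse α)) ≈ₚ fundQSym n α
fundQSym-reverse n α pos c =
  trans (cong (λ p → coeff p c) (reverseVars-map (seqMonomial n) (filterᵇ (fundSeqOk (descentSet (reverse α)) 1) (lists (sum (reverse α)) n))))
    (coeff-≡-by-fibre-bijection (lists-unique (sum (reverse α)) n) (lists-unique (sum α) n) (mirrorWord n) (mirrorWord n) forth back)
  where
  sum-rev = sum-↭ (↭-reverse α)
  forth : ∀ {s} → s ∈ lists (sum (reverse α)) n → InFibre (fundSeqOk (descentSet (reverse α)) 1) (Vec.reverse ∘ seqMonomial n) c s →
    mirrorWord n s ∈ lists (sum α) n ×
    InFibre (fundSeqOk (descentSet α) 1) (seqMonomial n) c (mirrorWord n s) ×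
    mirrorWord n (mirrorWord n s) ≡ s
  forth {s} s∈ (ok , weight) =
    let (|s| , inRange) = ∈-lists⁻ (sum (reverse α)) n s∈ in
    subst (λ k → mirrorWord n s ∈ lists k n) sum-rev (mirrorWord-∈-lists n (sum (reverse α)) s∈) ,
    ( subst (λ β → T (fundSeqOk (descentSet β) 1 (mirrorWord n s))) (reverse-involutive α)
        (fundSeqOk-mirrorWord n (reverse α) (All-reverse⁺ pos) |s| inRange ok)
    , trans (seqMonomial-mirrorWord n inRange) weight ) ,
    mirrorWord-involutive n inRange
  back : ∀ {s} → s ∈ lists (sum α) n → InFibre (fundSeqOk (descentSet α) 1) (seqMonomial n) c s →
    mirrorWord n s ∈ lists (sum (reverse α)) n ×
    InFibre (fundSeqOk (descentSet (reverse α)) 1) (Vec.reverse ∘ seqMonomial n) c (mirrorWord n s) ×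
    mirrorWord n (mirrorWord n s) ≡ s
  back {s} s∈ (ok , weight) =
    let (|s| , inRange) = ∈-lists⁻ (sum α) n s∈ in
    subst (λ k → mirrorWord n s ∈ lists k n) (sym sum-rev) (mirrorWord-∈-lists n (sum α) s∈) ,
    ( fundSeqOk-mirrorWord n α pos |s| inRange ok
    , trans (cong Vec.reverse (seqMonomial-mirrorWord n inRange)) (trans (Vec.reverse-involutive _) weight) ) ,
    mirrorWord-involutive n inRange

constantRows-map : ∀ (f : ℕ → ℕ) α is → constantRows α (map f is) ≡ map (map f) (constantRows α is)
constantRows-map f []      is       = refl
constantRows-map f (a ∷ α) []       = refl
constantRows-map f (a ∷ α) (i ∷ is) = cong₂ _∷_ (sym (map-replicate f a i)) (constantRows-map f α is)

constantRows-reverse : ∀ α is → length is ≡ length α → constantRows (reverse α) (reverse is) ≡ reverse (constantRows α is)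
constantRows-reverse []      []       _  = refl
constantRows-reverse (a ∷ α) (i ∷ is) eq = begin
  constantRows (reverse (a ∷ α)) (reverse (i ∷ is))           ≡⟨ cong₂ constantRows (unfold-reverse a α) (unfold-reverse i is) ⟩
  constantRows (reverse α ∷ʳ a) (reverse is ∷ʳ i)             ≡⟨ snoc (reverse α) (reverse is) (trans (length-reverse is) (trans |is| (sym (length-reverse α)))) ⟩
  constantRows (reverse α) (reverse is) ∷ʳ replicate a i      ≡⟨ cong (_∷ʳ replicate a i) (constantRows-reverse α is |is|) ⟩
  reverse (constantRows α is) ∷ʳ replicate a i                ≡⟨ unfold-reverse (replicate a i) (constantRows α is) ⟨
  reverse (constantRows (a ∷ α) (i ∷ is))                     ∎
  where
  open ≡-Reasoning
  |is| = suc-injective eq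
  snoc : ∀ β js → length js ≡ length β → constantRows (β ∷ʳ a) (js ∷ʳ i) ≡ constantRows β js ∷ʳ replicate a i
  snoc []      []       _  = refl
  snoc (b ∷ β) (j ∷ js) eq = cong (replicate b j ∷_) (snoc β js (suc-injective eq))

constantRows-InRange : ∀ {n} α {is} → All (InRange n) is → All (All (InRange n)) (constantRows α is)
constantRows-InRange []      _              = []
constantRows-InRange (a ∷ α) []             = []
constantRows-InRange (a ∷ α) (i-in ∷ is-in) = All.replicate⁺ a i-in ∷ constantRows-InRange α is-in

expMonomial-mirrorWord : ∀ n α {is} → length is ≡ length α → All (InRange n) is →
  expMonomial n (reverse α) (mirrorWord n is) ≡ Vec.reverse (expMonomial n α is)
expMonomial-mirrorWord n α {is} |is| inRange = begin
  expMonomial n (reverse α) (map (mirror n) (reverse is))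
    ≡⟨ expMonomial≡seqMonomial n (reverse α) (map (mirror n) (reverse is)) ⟩
  seqMonomial n (concat (constantRows (reverse α) (map (mirror n) (reverse is))))
    ≡⟨ cong (seqMonomial n ∘ concat) (constantRows-map (mirror n) (reverse α) (reverse is)) ⟩
  seqMonomial n (concat (map (map (mirror n)) (constantRows (reverse α) (reverse is))))
    ≡⟨ cong (seqMonomial n) (concat-map (constantRows (reverse α) (reverse is))) ⟩
  seqMonomial n (map (mirror n) (concat (constantRows (reverse α) (reverse is))))
    ≡⟨ seqMonomial-mirror n _ (All.concat⁺ (constantRows-InRange (reverse α) (All-reverse⁺ inRange))) ⟩
  Vec.reverse (seqMonomial n (concat (constantRows (reverse α) (reverse is))))
    ≡⟨ cong (Vec.reverse ∘ seqMonomial n ∘ concat) (constantRows-reverse α is |is|) ⟩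
  Vec.reverse (seqMonomial n (concat (reverse (constantRows α is))))
    ≡⟨ cong Vec.reverse (seqMonomial-↭ n (concat-reverse-↭ (constantRows α is))) ⟩
  Vec.reverse (seqMonomial n (concat (constantRows α is)))
    ≡⟨ cong Vec.reverse (expMonomial≡seqMonomial n α is) ⟨
  Vec.reverse (expMonomial n α is) ∎
  where open ≡-Reasoning

monQSym-reverse : ∀ n α → reverseVars (monQSym n (reverse α)) ≈ₚ monQSym n α
monQSym-reverse n α c =
  trans (cong (λ p → coeff p c) (reverseVars-map (expMonomial n (reverse α)) (filterᵇ strictlyIncreasing (lists (length (reverse α)) n))))
    (coeff-≡-by-fibre-bijection (lists-unique (length (reverse α)) n) (lists-unique (length α) n) (mirrorWord n) (mirrorWord n) forth back)
  where
  length-rev = length-reverse α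
  forth : ∀ {is} → is ∈ lists (length (reverse α)) n → InFibre strictlyIncreasing (Vec.reverse ∘ expMonomial n (reverse α)) c is →
    mirrorWord n is ∈ lists (length α) n ×
    InFibre strictlyIncreasing (expMonomial n α) c (mirrorWord n is) ×
    mirrorWord n (mirrorWord n is) ≡ is
  forth {is} is∈ (ok , weight) =
    let (|is| , inRange) = ∈-lists⁻ (length (reverse α)) n is∈ in
    subst (λ k → mirrorWord n is ∈ lists k n) length-rev (mirrorWord-∈-lists n (length (reverse α)) is∈) ,
    ( Equivalence.from T-strictlyIncreasing (mirrorWord-Sorted< n inRange (Equivalence.to T-strictlyIncreasing ok))
    , trans (subst (λ β → expMonomial n β (mirrorWord n is) ≡ Vec.reverse (expMonomial n (reverse α) is)) (reverse-involutive α)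
               (expMonomial-mirrorWord n (reverse α) |is| inRange)) weight ) ,
    mirrorWord-involutive n inRange
  back : ∀ {is} → is ∈ lists (length α) n → InFibre strictlyIncreasing (expMonomial n α) c is →
    mirrorWord n is ∈ lists (length (reverse α)) n ×
    InFibre strictlyIncreasing (Vec.reverse ∘ expMonomial n (reverse α)) c (mirrorWord n is) ×
    mirrorWord n (mirrorWord n is) ≡ is
  back {is} is∈ (ok , weight) =
    let (|is| , inRange) = ∈-lists⁻ (length α) n is∈ in
    subst (λ k → mirrorWord n is ∈ lists k n) (sym length-rev) (mirrorWord-∈-lists n (length α) is∈) ,
    ( Equivalence.from T-strictlyIncreasing (mirrorWord-Sorted< n inRange (Equivalence.to T-strictlyIncreasing ok))
    , trans (cong Vec.reverse (expMonomial-mirrorWord n α |is| inRange)) (trans (Vec.reverse-involutive _) weight) ) ,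
    mirrorWord-involutive n inRange

-- Fillings of weak compositions 0ᵏα

emptyRows-lengths : ∀ k {α} (X : List (List ℕ)) → map length X ≡ replicate k 0 ++ α →
  ∃[ X′ ] X ≡ replicate k [] ++ X′ × map length X′ ≡ α
emptyRows-lengths zero    X            lengths = X , refl , lengths
emptyRows-lengths (suc k) ([] ∷ X)     lengths with emptyRows-lengths k X (∷-injectiveʳ lengths)
... | X′ , refl , lengths′ = X′ , refl , lengths′
emptyRows-lengths (suc k) ((_ ∷ _) ∷ X) ()

RowsBounded-emptyRows⁻ : ∀ i k {X} → RowsBounded i (replicate k [] ++ X) → RowsBounded (i + k) X
RowsBounded-emptyRows⁻ i zero    {X} bounded       = subst (λ j → RowsBounded j X) (sym (+-identityʳ i)) bounded
RowsBounded-emptyRows⁻ i (suc k) {X} (_ , bounded) = subst (λ j → RowsBounded j X) (sym (+-suc i k)) (RowsBounded-emptyRows⁻ (suc i) k bounded)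

RowsBounded-emptyRows⁺ : ∀ i k {X} → RowsBounded (i + k) X → RowsBounded i (replicate k [] ++ X)
RowsBounded-emptyRows⁺ i zero    {X} bounded = subst (λ j → RowsBounded j X) (+-identityʳ i) bounded
RowsBounded-emptyRows⁺ i (suc k) {X} bounded = [] , RowsBounded-emptyRows⁺ (suc i) k (subst (λ j → RowsBounded j X) (+-suc i k) bounded)

concat-emptyRows : ∀ {A : Set} k (X : List (List A)) → concat (replicate k [] ++ X) ≡ concat X
concat-emptyRows zero    X = refl
concat-emptyRows (suc k) X = concat-emptyRows k X

FundFilling-emptyRows⁻ : ∀ k {X} → FundFilling (replicate k [] ++ X) → FundFilling X
FundFilling-emptyRows⁻ zero    fund                      = fund
FundFilling-emptyRows⁻ (suc k) (_ ∷ rows , _ ∷ sep) = FundFilling-emptyRows⁻ k (rows , sep)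

FundFilling-emptyRows⁺ : ∀ k {X} → FundFilling X → FundFilling (replicate k [] ++ X)
FundFilling-emptyRows⁺ zero    fund = fund
FundFilling-emptyRows⁺ (suc k) fund =
  let (rows , sep) = FundFilling-emptyRows⁺ k fund in [] ∷ rows , All.tabulate (λ _ → []) ∷ sep

Constant-emptyRows⁻ : ∀ k {X} → All Constant (replicate k [] ++ X) → All Constant X
Constant-emptyRows⁻ zero    const       = const
Constant-emptyRows⁻ (suc k) (_ ∷ const) = Constant-emptyRows⁻ k const

Constant-emptyRows⁺ : ∀ k {X} → All Constant X → All Constant (replicate k [] ++ X)
Constant-emptyRows⁺ zero    const = const
Constant-emptyRows⁺ (suc k) const = tt ∷ Constant-emptyRows⁺ k const

RowsBounded⇒InRange : ∀ {n} s X → RowsBounded s X → s + length X ≡ suc n → All (All (InRange n)) X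
RowsBounded⇒InRange s []      _                     _    = []
RowsBounded⇒InRange s (r ∷ X) (r-inRange , bounded) size =
  All.map (InRange-mono s≤n) r-inRange ∷ RowsBounded⇒InRange (suc s) X bounded (trans (sym (+-suc s (length X))) size)
  where
  s≤n = ≤-pred (subst (suc s ≤_) (trans (sym (+-suc s (length X))) size) (s≤s (m≤m+n s (length X))))

-- Strict separation makes the first entries grow by at least one per row, and the top row is bounded by
-- n, so every row is bounded by its index.
FundFilling⇒RowsBounded : ∀ {n} s X → FundFilling X → All NonEmpty X → All (All (InRange n)) X → s + length X ≡ suc n → RowsBounded s X
FundFilling⇒RowsBounded s []      _                               _            _                  _    = tt
FundFilling⇒RowsBounded {n} s (R ∷ X) (sortedR ∷ sorted , R≪X ∷ sep) (neR ∷ neX) (R-inRange ∷ inRange) size =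
  All.tabulate (λ x∈R → proj₁ (All.lookup R-inRange x∈R) , ≤-trans (≤-first sortedR x∈R) (first≤s X R≪X neX rest size)) , rest
  where
  size′ = trans (sym (+-suc s (length X))) size
  rest  = FundFilling⇒RowsBounded (suc s) X (sorted , sep) neX inRange size′
  ≤-first : ∀ {R x} → Sorted≥ R → x ∈ R → x ≤ first R
  ≤-first _             (here refl) = ≤-refl
  ≤-first (R≤x ∷ _) (there x∈R) = All.lookup R≤x x∈R
  first≤s : ∀ X → All (R ≪_) X → All NonEmpty X → RowsBounded (suc s) X → s + suc (length X) ≡ suc n → first R ≤ s
  first≤s []       _             _            _                 size =
    ≤-trans (proj₂ (All.lookup R-inRange (first∈ neR)))
            (≤-reflexive (sym (trans (sym (+-identityʳ s)) (suc-injective (trans (sym (+-suc s 0)) size)))))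
  first≤s (R′ ∷ _) (R≪R′ ∷ _) (neR′ ∷ _) (R′-inRange , _) _ =
    ≤-pred (≤-trans (All.lookup (All.lookup R≪R′ (first∈ neR)) (first∈ neR′)) (proj₂ (All.lookup R′-inRange (first∈ neR′))))

heads : List (List ℕ) → List ℕ
heads []            = []
heads ([] ∷ X)      = heads X
heads ((x ∷ _) ∷ X) = x ∷ heads X

heads-emptyRows : ∀ k X → heads (replicate k [] ++ X) ≡ heads X
heads-emptyRows zero    X = refl
heads-emptyRows (suc k) X = heads-emptyRows k X

length-heads : ∀ {X} → All NonEmpty X → length (heads X) ≡ length X
length-heads {[]}          []         = refl
length-heads {(_ ∷ _) ∷ X} (_ ∷ neX) = cong suc (length-heads neX)

heads-InRange : ∀ {n X} → All NonEmpty X → All (All (InRange n)) X → All (InRange n) (heads X)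
heads-InRange {X = []}          []          []                 = []
heads-InRange {X = (_ ∷ _) ∷ X} (_ ∷ neX) ((x-in ∷ _) ∷ inX) = x-in ∷ heads-InRange neX inX

heads-Sorted< : ∀ {X} → All NonEmpty X → AllPairs _≪_ X → Sorted< (heads X)
heads-Sorted< {[]}           []         []             = []
heads-Sorted< {(x ∷ r) ∷ X} (_ ∷ neX) (x∷r≪X ∷ sep) = below neX x∷r≪X ∷ heads-Sorted< neX sep
  where
  below : ∀ {Y} → All NonEmpty Y → All (x ∷ r ≪_) Y → All (x <_) (heads Y)
  below {[]}          []          []              = []
  below {(_ ∷ _) ∷ Y} (_ ∷ neY) (x∷r≪y ∷ rest) = All.head (All.head x∷r≪y) ∷ below neY rest

constantRows-heads : ∀ {X} → All Constant X → All NonEmpty X → X ≡ constantRows (map length X) (heads X)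
constantRows-heads {[]}          []                []         = refl
constantRows-heads {(x ∷ r) ∷ X} (r≡x ∷ constant) (_ ∷ neX) = cong₂ _∷_ (row r r≡x) (constantRows-heads constant neX)
  where
  row : ∀ r → All (_≡ x) r → x ∷ r ≡ replicate (suc (length r)) x
  row []      []           = refl
  row (_ ∷ r) (refl ∷ r≡x) = cong (x ∷_) (row r r≡x)

heads-constantRows : ∀ {α is} → All (0 <_) α → length is ≡ length α → heads (constantRows α is) ≡ is
heads-constantRows {[]}        {[]}     []        _  = refl
heads-constantRows {suc a ∷ α} {i ∷ is} (_ ∷ pos) eq = cong (i ∷_) (heads-constantRows pos (suc-injective eq))

map-length-constantRows : ∀ α {is} → length is ≡ length α → map length (constantRows α is) ≡ α
map-length-constantRows []      {[]}     _  = refl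
map-length-constantRows (a ∷ α) {i ∷ is} eq = cong₂ _∷_ (length-replicate a) (map-length-constantRows α (suc-injective eq))

constantRows-Constant : ∀ α is → All Constant (constantRows α is)
constantRows-Constant []      is       = []
constantRows-Constant (a ∷ α) []       = []
constantRows-Constant (a ∷ α) (i ∷ is) = row a ∷ constantRows-Constant α is
  where
  row : ∀ a → Constant (replicate a i)
  row zero    = tt
  row (suc a) = All.replicate⁺ a refl

constantRows-FundFilling : ∀ α {is} → Sorted< is → FundFilling (constantRows α is)
constantRows-FundFilling []      _                = [] , []
constantRows-FundFilling (a ∷ α) {[]}    _        = [] , []
constantRows-FundFilling (a ∷ α) {i ∷ is} (i<is ∷ sorted) =
  let (rows , sep) = constantRows-FundFilling α sorted
  in constant a ∷ rows , below α i<is ∷ sep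
  where
  constant : ∀ a → Sorted≥ (replicate a i)
  constant zero    = []
  constant (suc a) = All.replicate⁺ a ≤-refl ∷ constant a
  below : ∀ β {js} → All (i <_) js → All (replicate a i ≪_) (constantRows β js)
  below []      _                 = []
  below (b ∷ β) {[]}    _         = []
  below (b ∷ β) {j ∷ js} (i<j ∷ rest) = All.replicate⁺ a (All.replicate⁺ b i<j) ∷ below β rest

length-concat : ∀ (X : List (List ℕ)) → length (concat X) ≡ sum (map length X)
length-concat []      = refl
length-concat (r ∷ X) = trans (length-++ r) (cong (length r +_) (length-concat X))

map-reverse-involutive : ∀ (X : List (List ℕ)) → map reverse (map reverse X) ≡ X
map-reverse-involutive []      = refl
map-reverse-involutive (r ∷ X) = cong₂ _∷_ (reverse-involutive r) (map-reverse-involutive X)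

map-length⇒length : ∀ {A : Set} {X : List (List A)} {α} → map length X ≡ α → length X ≡ length α
map-length⇒length {X = X} lengths = trans (sym (length-map length X)) (cong length lengths)

module ZeroPadded {n k : ℕ} {α : List ℕ} (a : Vec ℕ n) (a≡0ᵏα : toList a ≡ replicate k 0 ++ α) (α-pos : All (0 <_) α) where

  padded : List (List ℕ) → List (List ℕ)
  padded X = replicate k [] ++ X

  size : suc k + length α ≡ suc n
  size = cong suc (begin
    k + length α                         ≡⟨ cong (_+ length α) (length-replicate k) ⟨
    length (replicate k 0) + length α    ≡⟨ length-++ (replicate k 0) ⟨
    length (replicate k 0 ++ α)          ≡⟨ cong length a≡0ᵏα ⟨
    length (toList a)                    ≡⟨ Vec.length-toList a ⟩
    n                                    ∎)
    where open ≡-Reasoning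

  ∈-candidates⁻ : ∀ {X} → X ∈ candidates a → ∃[ X′ ] X ≡ padded X′ × map length X′ ≡ α × RowsBounded (suc k) X′
  ∈-candidates⁻ {X} X∈ with ∈-rowCandidates⁻ 1 (toList a) X∈
  ... | lengths , bounded with emptyRows-lengths k X (trans lengths a≡0ᵏα)
  ...   | X′ , refl , lengths′ = X′ , refl , lengths′ , RowsBounded-emptyRows⁻ 1 k bounded

  rows-InRange : ∀ {X′} → map length X′ ≡ α → RowsBounded (suc k) X′ → All (All (InRange n)) X′
  rows-InRange {X′} lengths bounded = RowsBounded⇒InRange (suc k) X′ bounded (trans (cong (suc k +_) (map-length⇒length lengths)) size)

  FundFilling⇒∈-candidates : ∀ {X′} → map length X′ ≡ α → FundFilling X′ → All (All (InRange n)) X′ → padded X′ ∈ candidates a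
  FundFilling⇒∈-candidates {X′} lengths fund inRange = subst (λ ks → padded X′ ∈ product (rowCandidates 1 ks)) padded-lengths
    (∈-rowCandidates⁺ 1 (padded X′) (RowsBounded-emptyRows⁺ 1 k
      (FundFilling⇒RowsBounded (suc k) X′ fund (NonEmpty-lengths (subst (All (0 <_)) (sym lengths) α-pos)) inRange
        (trans (cong (suc k +_) (map-length⇒length lengths)) size))))
    where
    padded-lengths : map length (padded X′) ≡ toList a
    padded-lengths = trans (map-++ length (replicate k []) X′)
      (trans (cong₂ _++_ (map-replicate length k []) lengths) (sym a≡0ᵏα))

  readingWord : List (List ℕ) → List ℕ
  readingWord X = concat (map reverse X)

  readingWord-padded : ∀ X′ → readingWord (padded X′) ≡ concat (map reverse X′)
  readingWord-padded X′ = trans (cong concat (trans (map-++ reverse (replicate k []) X′) (cong (_++ map reverse X′) (map-replicate reverse k []))))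
                                (concat-emptyRows k (map reverse X′))

  unread : List ℕ → List (List ℕ)
  unread s = padded (map reverse (chop α s))

  readingWord-fibre : ∀ {c X} → X ∈ candidates a → InFibre isFundFilling (weightOf n) c X →
    readingWord X ∈ lists (sum α) n ×
    InFibre (fundSeqOk (descentSet α) 1) (seqMonomial n) c (readingWord X) ×
    unread (readingWord X) ≡ X
  readingWord-fibre {X = X} X∈ (fund , weight) with ∈-candidates⁻ X∈
  ... | X′ , refl , lengths , bounded =
    subst (_∈ lists (sum α) n) (sym word≡) (∈-lists⁺ (sum α) n (trans (length-concat Bs) (cong sum Bs-lengths)) (All.concat⁺ Bs-inRange)) ,
    ( Equivalence.from (T-fundSeqOk⇔StrongChain Bs α-pos Bs-lengths (sym word≡))
        (FundFilling⇒StrongChain (FundFilling-emptyRows⁻ k (Equivalence.to T-isFundFilling fund)))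
    , trans (seqMonomial-↭ n (concat-map-reverse-↭ X)) weight ) ,
    cong padded (begin
      map reverse (chop α (readingWord X))       ≡⟨ cong (λ s → map reverse (chop α s)) word≡ ⟩
      map reverse (chop α (concat Bs))           ≡⟨ cong (λ β → map reverse (chop β (concat Bs))) Bs-lengths ⟨
      map reverse (chop (map length Bs) (concat Bs)) ≡⟨ cong (map reverse) (chop-concat Bs) ⟩
      map reverse Bs                             ≡⟨ map-reverse-involutive X′ ⟩
      X′                                         ∎)
    where
    open ≡-Reasoning
    Bs = map reverse X′
    word≡ = readingWord-padded X′
    Bs-lengths = trans (trans (sym (map-∘ X′)) (map-cong length-reverse X′)) lengths
    Bs-inRange = All.map⁺ (All.map All-reverse⁺ (rows-InRange lengths bounded))

  unread-fibre : ∀ {c s} → s ∈ lists (sum α) n → InFibre (fundSeqOk (descentSet α) 1) (seqMonomial n) c s →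
    unread s ∈ candidates a × InFibre isFundFilling (weightOf n) c (unread s) × readingWord (unread s) ≡ s
  unread-fibre {s = s} s∈ (ok , weight) =
    FundFilling⇒∈-candidates X′-lengths fund X′-inRange ,
    ( Equivalence.from T-isFundFilling (FundFilling-emptyRows⁺ k fund)
    , trans (seqMonomial-↭ n (↭-sym (concat-map-reverse-↭ (unread s)))) (trans (cong (seqMonomial n) word≡) weight) ) ,
    word≡
    where
    |s|        = proj₁ (∈-lists⁻ (sum α) n s∈)
    Bs         = chop α s
    Bs-lengths = map-length-chop α s |s|
    concat-Bs  = concat-chop α s |s|
    X′         = map reverse Bs
    fund       = StrongChain⇒FundFilling (Equivalence.to (T-fundSeqOk⇔StrongChain Bs α-pos Bs-lengths concat-Bs) ok)
    X′-lengths = trans (trans (sym (map-∘ Bs)) (map-cong length-reverse Bs)) Bs-lengths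
    X′-inRange = All.map⁺ (All.map All-reverse⁺ (All.concat⁻ (subst (All (InRange n)) (sym concat-Bs) (proj₂ (∈-lists⁻ (sum α) n s∈)))))
    word≡ : readingWord (unread s) ≡ s
    word≡ = trans (readingWord-padded X′) (trans (cong concat (map-reverse-involutive Bs)) concat-Bs)

  fundSlide≈ : fundSlide a ≈ₚ fundQSym n α
  fundSlide≈ c =
    coeff-≡-by-fibre-bijection (candidates-unique a) (lists-unique (sum α) n) readingWord unread readingWord-fibre unread-fibre

  heads-fibre : ∀ {c X} → X ∈ candidates a → InFibre isMonFilling (weightOf n) c X →
    heads X ∈ lists (length α) n ×
    InFibre strictlyIncreasing (expMonomial n α) c (heads X) ×
    padded (constantRows α (heads X)) ≡ X
  heads-fibre {c} {X} X∈ (mon , weight) with ∈-candidates⁻ X∈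
  ... | X′ , refl , lengths , bounded =
    subst (_∈ lists (length α) n) (sym heads≡)
      (∈-lists⁺ (length α) n (trans (length-heads nonEmpty) (map-length⇒length lengths)) (heads-InRange nonEmpty (rows-InRange lengths bounded))) ,
    ( subst (T ∘ strictlyIncreasing) (sym heads≡) (Equivalence.from T-strictlyIncreasing (heads-Sorted< nonEmpty (proj₂ fund)))
    , (begin
        expMonomial n α (heads X)                           ≡⟨ expMonomial≡seqMonomial n α (heads X) ⟩
        seqMonomial n (concat (constantRows α (heads X)))   ≡⟨ cong (seqMonomial n ∘ concat) rows≡ ⟨
        seqMonomial n (concat X′)                           ≡⟨ cong (seqMonomial n) (concat-emptyRows k X′) ⟨
        weightOf n X                                        ≡⟨ weight ⟩
        c                                                   ∎) ) ,
    cong padded (sym rows≡)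
    where
    open ≡-Reasoning
    fund     = FundFilling-emptyRows⁻ k (proj₁ (Equivalence.to T-isMonFilling mon))
    constant = Constant-emptyRows⁻ k (proj₂ (Equivalence.to T-isMonFilling mon))
    nonEmpty = NonEmpty-lengths (subst (All (0 <_)) (sym lengths) α-pos)
    heads≡   = heads-emptyRows k X′
    rows≡ : X′ ≡ constantRows α (heads X)
    rows≡ = trans (constantRows-heads constant nonEmpty) (cong₂ constantRows lengths (sym heads≡))

  constantRows-fibre : ∀ {c is} → is ∈ lists (length α) n → InFibre strictlyIncreasing (expMonomial n α) c is →
    padded (constantRows α is) ∈ candidates a ×
    InFibre isMonFilling (weightOf n) c (padded (constantRows α is)) ×
    heads (padded (constantRows α is)) ≡ is
  constantRows-fibre {is = is} is∈ (ok , weight) =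
    FundFilling⇒∈-candidates (map-length-constantRows α |is|) fund (constantRows-InRange α is-inRange) ,
    ( Equivalence.from T-isMonFilling (FundFilling-emptyRows⁺ k fund , Constant-emptyRows⁺ k (constantRows-Constant α is))
    , trans (cong (seqMonomial n) (concat-emptyRows k (constantRows α is))) (trans (sym (expMonomial≡seqMonomial n α is)) weight) ) ,
    trans (heads-emptyRows k (constantRows α is)) (heads-constantRows α-pos |is|)
    where
    |is|       = proj₁ (∈-lists⁻ (length α) n is∈)
    is-inRange = proj₂ (∈-lists⁻ (length α) n is∈)
    fund       = constantRows-FundFilling α (Equivalence.to T-strictlyIncreasing ok)

  monSlide≈ : monSlide a ≈ₚ monQSym n α
  monSlide≈ c =
    coeff-≡-by-fibre-bijection (candidates-unique a) (lists-unique (length α) n) heads (padded ∘ constantRows α) heads-fibre constantRows-fibre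

-- Young slide polynomials

toList-reverse-++-replicate : ∀ {n} (b : Vec ℕ n) {α k} → toList b ≡ α ++ replicate k 0 → toList (Vec.reverse b) ≡ replicate k 0 ++ reverse α
toList-reverse-++-replicate b {α} {k} b≡α0ᵏ = begin
  toList (Vec.reverse b)              ≡⟨ Vec.toList-reverse b ⟩
  reverse (toList b)                  ≡⟨ cong reverse b≡α0ᵏ ⟩
  reverse (α ++ replicate k 0)        ≡⟨ reverse-++ α (replicate k 0) ⟩
  reverse (replicate k 0) ++ reverse α ≡⟨ cong (_++ reverse α) (reverse-replicate k) ⟩
  replicate k 0 ++ reverse α          ∎
  where
  open ≡-Reasoning
  reverse-replicate : ∀ k → reverse (replicate k 0) ≡ replicate k 0
  reverse-replicate zero    = refl
  reverse-replicate (suc k) = begin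
    reverse (replicate (suc k) 0) ≡⟨ unfold-reverse 0 (replicate k 0) ⟩
    reverse (replicate k 0) ∷ʳ 0  ≡⟨ cong (_∷ʳ 0) (reverse-replicate k) ⟩
    replicate k 0 ∷ʳ 0            ≡⟨ replicate-∷ʳ k ⟩
    replicate (suc k) 0           ∎
    where
    replicate-∷ʳ : ∀ k → replicate k 0 ∷ʳ 0 ≡ replicate (suc k) 0
    replicate-∷ʳ zero    = refl
    replicate-∷ʳ (suc k) = cong (0 ∷_) (replicate-∷ʳ k)

youngFundSlide≈ : ∀ {n k α} (b : Vec ℕ n) → toList b ≡ α ++ replicate k 0 → All (0 <_) α → youngFundSlide b ≈ₚ fundQSym n α
youngFundSlide≈ {n} {k} {α} b b≡α0ᵏ pos c =
  trans (reverseVars-cong {p = fundSlide (Vec.reverse b)} {q = fundQSym n (reverse α)} slide≈ c) (fundQSym-reverse n α pos c)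
  where
  slide≈ : fundSlide (Vec.reverse b) ≈ₚ fundQSym n (reverse α)
  slide≈ = ZeroPadded.fundSlide≈ {k = k} (Vec.reverse b) (toList-reverse-++-replicate b {α} {k} b≡α0ᵏ) (All-reverse⁺ pos)

youngMonSlide≈ : ∀ {n k α} (b : Vec ℕ n) → toList b ≡ α ++ replicate k 0 → All (0 <_) α → youngMonSlide b ≈ₚ monQSym n α
youngMonSlide≈ {n} {k} {α} b b≡α0ᵏ pos c =
  trans (reverseVars-cong {p = monSlide (Vec.reverse b)} {q = monQSym n (reverse α)} slide≈ c) (monQSym-reverse n α c)
  where
  slide≈ : monSlide (Vec.reverse b) ≈ₚ monQSym n (reverse α)
  slide≈ = ZeroPadded.monSlide≈ {k = k} (Vec.reverse b) (toList-reverse-++-replicate b {α} {k} b≡α0ᵏ) (All-reverse⁺ pos)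

-- Terms of slide polynomials

∈-map-filterᵇ⁻ : ∀ {A : Set} {n} {w : A → Monomial n} {P : A → Bool} L {c} → c ∈ map w (filterᵇ P L) → ∃[ x ] x ∈ L × T (P x) × w x ≡ c
∈-map-filterᵇ⁻ {P = P} L c∈ with ∈-map⁻ _ c∈
... | x , x∈ , refl = let (x∈L , Px) = ∈-filter⁻ (T? ∘ P) {xs = L} x∈ in x , x∈L , Px , refl

∈-map-filterᵇ⁺ : ∀ {A : Set} {n} {w : A → Monomial n} {P : A → Bool} {L x c} → x ∈ L → T (P x) → w x ≡ c → c ∈ map w (filterᵇ P L)
∈-map-filterᵇ⁺ {w = w} {P} x∈L Px refl = ∈-map⁺ w (∈-filter⁺ (T? ∘ P) x∈L Px)

∈-reverseVars⁻ : ∀ {n} {p : Poly n} {c} → c ∈ reverseVars p → Vec.reverse c ∈ p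
∈-reverseVars⁻ c∈ with ∈-map⁻ Vec.reverse c∈
... | m , m∈p , refl = subst (_∈ _) (sym (Vec.reverse-involutive m)) m∈p

canonicalFrom : ℕ → List ℕ → List (List ℕ)
canonicalFrom i []       = []
canonicalFrom i (k ∷ ks) = replicate k i ∷ canonicalFrom (suc i) ks

map-length-canonicalFrom : ∀ i ks → map length (canonicalFrom i ks) ≡ ks
map-length-canonicalFrom i []       = refl
map-length-canonicalFrom i (k ∷ ks) = cong₂ _∷_ (length-replicate k) (map-length-canonicalFrom (suc i) ks)

canonicalFrom-RowsBounded : ∀ i ks → 1 ≤ i → RowsBounded i (canonicalFrom i ks)
canonicalFrom-RowsBounded i []       _   = tt
canonicalFrom-RowsBounded i (k ∷ ks) 1≤i = All.replicate⁺ k (1≤i , ≤-refl) , canonicalFrom-RowsBounded (suc i) ks (≤-trans 1≤i (n≤1+n i))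

canonicalFrom-MonFilling : ∀ i ks → MonFilling (canonicalFrom i ks)
canonicalFrom-MonFilling i ks = (rows i ks , sep i ks) , constant i ks
  where
  rows : ∀ i ks → All Sorted≥ (canonicalFrom i ks)
  rows i []       = []
  rows i (k ∷ ks) = row k ∷ rows (suc i) ks
    where
    row : ∀ k → Sorted≥ (replicate k i)
    row zero    = []
    row (suc k) = All.replicate⁺ k ≤-refl ∷ row k
  above : ∀ i j ks → i < j → All (All (i <_)) (canonicalFrom j ks)
  above i j []       _   = []
  above i j (k ∷ ks) i<j = All.replicate⁺ k i<j ∷ above i (suc j) ks (≤-trans i<j (n≤1+n j))
  sep : ∀ i ks → AllPairs _≪_ (canonicalFrom i ks)
  sep i []       = []
  sep i (k ∷ ks) = All.map (λ i<row → All.replicate⁺ k i<row) (above i (suc i) ks ≤-refl) ∷ sep (suc i) ks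
  constant : ∀ i ks → All Constant (canonicalFrom i ks)
  constant i []       = []
  constant i (zero  ∷ ks) = tt ∷ constant (suc i) ks
  constant i (suc k ∷ ks) = All.replicate⁺ k refl ∷ constant (suc i) ks

counts-canonicalFrom : ∀ i ks → applyUpTo (λ m → countℕ (i + m) (concat (canonicalFrom i ks))) (length ks) ≡ ks
counts-canonicalFrom i []       = refl
counts-canonicalFrom i (k ∷ ks) = cong₂ _∷_ row-i rest
  where
  higher = concat (canonicalFrom (suc i) ks)
  no-i-higher : ∀ j ks → i < j → countℕ i (concat (canonicalFrom j ks)) ≡ 0
  no-i-higher j ks i<j = Equivalence.from (countℕ≡0⇔ i _) (above j ks i<j)
    where
    above : ∀ j ks → i < j → All (_≢ i) (concat (canonicalFrom j ks))
    above j []       _   = []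
    above j (k ∷ ks) i<j = All.++⁺ (All.replicate⁺ k (λ j≡i → <⇒≢ i<j (sym j≡i))) (above (suc j) ks (≤-trans i<j (n≤1+n j)))
  row-i : countℕ (i + 0) (replicate k i ++ higher) ≡ k
  row-i = begin
    countℕ (i + 0) (replicate k i ++ higher)                 ≡⟨ cong (λ u → countℕ u (replicate k i ++ higher)) (+-identityʳ i) ⟩
    countℕ i (replicate k i ++ higher)                       ≡⟨ countℕ-++ i (replicate k i) higher ⟩
    countℕ i (replicate k i) + countℕ i higher               ≡⟨ cong₂ _+_ (countℕ-replicate i k i) (no-i-higher (suc i) ks ≤-refl) ⟩
    (if i ≡ᵇ i then k else 0) + 0                            ≡⟨ cong (λ b → (if b then k else 0) + 0) (≡ᵇ-true {i} refl) ⟩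
    k + 0                                                    ≡⟨ +-identityʳ k ⟩
    k                                                        ∎
    where open ≡-Reasoning
  shift : ∀ m → countℕ (i + suc m) (replicate k i ++ higher) ≡ countℕ (suc i + m) higher
  shift m = begin
    countℕ (i + suc m) (replicate k i ++ higher)                  ≡⟨ cong (λ u → countℕ u (replicate k i ++ higher)) (+-suc i m) ⟩
    countℕ (suc i + m) (replicate k i ++ higher)                  ≡⟨ countℕ-++ (suc i + m) (replicate k i) higher ⟩
    countℕ (suc i + m) (replicate k i) + countℕ (suc i + m) higher ≡⟨ cong (_+ countℕ (suc i + m) higher) no-higher-in-row ⟩
    countℕ (suc i + m) higher                                     ∎
    where
    open ≡-Reasoning
    no-higher-in-row = Equivalence.from (countℕ≡0⇔ _ (replicate k i)) (All.replicate⁺ k (<⇒≢ (s≤s (m≤m+n i m))))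
  rest : applyUpTo (λ m → countℕ (i + suc m) (replicate k i ++ higher)) (length ks) ≡ ks
  rest = trans (applyUpTo-cong< (length ks) (λ m _ → shift m)) (counts-canonicalFrom (suc i) ks)

weight-canonicalFrom : ∀ {n} (a : Vec ℕ n) → weightOf n (canonicalFrom 1 (toList a)) ≡ a
weight-canonicalFrom {n} a = toList-injective (begin
  toList (weightOf n (canonicalFrom 1 (toList a)))                                 ≡⟨ toList-seqMonomial n (concat (canonicalFrom 1 (toList a))) ⟩
  applyUpTo (λ m → countℕ (1 + m) (concat (canonicalFrom 1 (toList a)))) n          ≡⟨ cong (applyUpTo _) (Vec.length-toList a) ⟨
  applyUpTo (λ m → countℕ (1 + m) (concat (canonicalFrom 1 (toList a)))) (length (toList a)) ≡⟨ counts-canonicalFrom 1 (toList a) ⟩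
  toList a                                                                          ∎)
  where open ≡-Reasoning

sum-applyUpTo-+ : ∀ i (f g : ℕ → ℕ) → sum (applyUpTo (λ m → f m + g m) i) ≡ sum (applyUpTo f i) + sum (applyUpTo g i)
sum-applyUpTo-+ zero    f g = refl
sum-applyUpTo-+ (suc i) f g = begin
  f 0 + g 0 + sum (applyUpTo (λ m → f (suc m) + g (suc m)) i)      ≡⟨ cong (f 0 + g 0 +_) (sum-applyUpTo-+ i (f ∘ suc) (g ∘ suc)) ⟩
  f 0 + g 0 + (sum (applyUpTo (f ∘ suc) i) + sum (applyUpTo (g ∘ suc) i)) ≡⟨ +-comm-middle (f 0) (g 0) _ _ ⟩
  f 0 + sum (applyUpTo (f ∘ suc) i) + (g 0 + sum (applyUpTo (g ∘ suc) i)) ∎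
  where
  open ≡-Reasoning
  +-comm-middle : ∀ a b c d → a + b + (c + d) ≡ a + c + (b + d)
  +-comm-middle a b c d = begin
    a + b + (c + d)   ≡⟨ +-assoc a b (c + d) ⟩
    a + (b + (c + d)) ≡⟨ cong (a +_) (+-comm-left b c d) ⟩
    a + (c + (b + d)) ≡⟨ +-assoc a c (b + d) ⟨
    a + c + (b + d)   ∎
    where
    +-comm-left : ∀ b c d → b + (c + d) ≡ c + (b + d)
    +-comm-left b c d = trans (sym (+-assoc b c d)) (trans (cong (_+ d) (+-comm b c)) (+-assoc c b d))

sum-applyUpTo-mono : ∀ i {f g : ℕ → ℕ} → (∀ m → f m ≤ g m) → sum (applyUpTo f i) ≤ sum (applyUpTo g i)
sum-applyUpTo-mono zero    f≤g = z≤n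
sum-applyUpTo-mono (suc i) f≤g = +-mono-≤ (f≤g 0) (sum-applyUpTo-mono i (f≤g ∘ suc))

sum-counts : ∀ i Y → All (InRange i) Y → sum (applyUpTo (λ m → countℕ (suc m) Y) i) ≡ length Y
sum-counts i []      [] = zeros i
  where
  zeros : ∀ i → sum (applyUpTo (λ _ → 0) i) ≡ 0
  zeros zero    = refl
  zeros (suc i) = zeros i
sum-counts i (e ∷ Y) (e-in ∷ Y-in) = begin
  sum (applyUpTo (λ m → countℕ (suc m) ([ e ] ++ Y)) i)                                   ≡⟨ cong sum (applyUpTo-cong< i (λ m _ → countℕ-++ (suc m) [ e ] Y)) ⟩
  sum (applyUpTo (λ m → countℕ (suc m) [ e ] + countℕ (suc m) Y) i)                       ≡⟨ sum-applyUpTo-+ i _ _ ⟩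
  sum (applyUpTo (λ m → countℕ (suc m) [ e ]) i) + sum (applyUpTo (λ m → countℕ (suc m) Y) i) ≡⟨ cong₂ _+_ (single i e e-in) (sum-counts i Y Y-in) ⟩
  suc (length Y)                                                                          ∎
  where
  open ≡-Reasoning
  single : ∀ i e → InRange i e → sum (applyUpTo (λ m → countℕ (suc m) [ e ]) i) ≡ 1
  single (suc i) (suc zero)    _               = cong suc (sum-counts i [] [])
  single (suc i) (suc (suc e)) (_ , s≤s e<i) =
    trans (cong sum (applyUpTo-cong< i (λ m _ → countℕ-map suc (suc (suc m)) (suc m) {[ suc e ]} (mk⇔ suc-injective (cong suc) ∷ []))))
          (single i (suc e) (s≤s z≤n , e<i))

applyUpTo-prefix : ∀ (h : ℕ → ℕ) {n} P {Q} → applyUpTo h n ≡ P ++ Q → applyUpTo h (length P) ≡ P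
applyUpTo-prefix h         []      eq = refl
applyUpTo-prefix h {suc n} (p ∷ P) eq = cong₂ _∷_ (∷-injectiveˡ eq) (applyUpTo-prefix (h ∘ suc) P (∷-injectiveʳ eq))

applyUpTo-at : ∀ (h : ℕ → ℕ) {n} P {x Q} → applyUpTo h n ≡ P ++ x ∷ Q → h (length P) ≡ x
applyUpTo-at h {suc n} []      eq = ∷-injectiveˡ eq
applyUpTo-at h {suc n} (p ∷ P) eq = applyUpTo-at (h ∘ suc) P (∷-injectiveʳ eq)

split-rows : ∀ (X : List (List ℕ)) us {vs} → map length X ≡ us ++ vs → ∃[ X₁ ] ∃[ X₂ ] X ≡ X₁ ++ X₂ × map length X₁ ≡ us
split-rows X       []       _       = [] , X , refl , refl
split-rows (r ∷ X) (u ∷ us) lengths with split-rows X us (∷-injectiveʳ lengths)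
... | X₁ , X₂ , refl , lengths₁ = r ∷ X₁ , X₂ , refl , cong₂ _∷_ (∷-injectiveˡ lengths) lengths₁

RowsBounded-++⁻ : ∀ i X₁ {X₂} → RowsBounded i (X₁ ++ X₂) → RowsBounded i X₁
RowsBounded-++⁻ i []       _                 = tt
RowsBounded-++⁻ i (r ∷ X₁) (r-in , bounded) = r-in , RowsBounded-++⁻ (suc i) X₁ bounded

-- The entries of the first i rows of a filling of a are at most i.
dominance : ∀ {n} (a : Vec ℕ n) {X} → X ∈ candidates a → ∀ us {vs us′ vs′} →
  toList a ≡ us ++ vs → toList (weightOf n X) ≡ us′ ++ vs′ → length us′ ≡ length us → sum us ≤ sum us′
dominance {n} a {X} X∈ us {us′ = us′} a≡ w≡ |us′| with ∈-rowCandidates⁻ 1 (toList a) X∈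
... | lengths , bounded with split-rows X us (trans lengths a≡)
... | X₁ , X₂ , refl , lengths₁ = begin
  sum us                                                         ≡⟨ cong sum lengths₁ ⟨
  sum (map length X₁)                                            ≡⟨ length-concat X₁ ⟨
  length (concat X₁)                                             ≡⟨ sum-counts (length us) (concat X₁) low ⟨
  sum (applyUpTo (λ m → countℕ (suc m) (concat X₁)) (length us)) ≤⟨ sum-applyUpTo-mono (length us) more ⟩
  sum (applyUpTo (λ m → countℕ (suc m) (concat X)) (length us))  ≡⟨ cong (λ i → sum (applyUpTo _ i)) |us′| ⟨
  sum (applyUpTo (λ m → countℕ (suc m) (concat X)) (length us′)) ≡⟨ cong sum (applyUpTo-prefix _ us′ (trans (sym (toList-seqMonomial n (concat X))) w≡)) ⟩
  sum us′                                                        ∎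
  where
  open ≤-Reasoning
  low : All (InRange (length us)) (concat X₁)
  low = All.concat⁺ (RowsBounded⇒InRange 1 X₁ (RowsBounded-++⁻ 1 X₁ bounded) (cong suc (map-length⇒length lengths₁)))
  more : ∀ m → countℕ (suc m) (concat X₁) ≤ countℕ (suc m) (concat X)
  more m = subst (countℕ (suc m) (concat X₁) ≤_)
    (trans (sym (countℕ-++ (suc m) (concat X₁) (concat X₂))) (cong (countℕ (suc m)) (concat-++ X₁ X₂)))
    (m≤m+n _ _)

lower : ℕ → ℕ → ℕ
lower t e = if e ≡ᵇ suc (suc t) then suc t else e

lower-top : ∀ t → lower t (suc (suc t)) ≡ suc t
lower-top t = cong (if_then suc t else suc (suc t)) (≡ᵇ-true {suc (suc t)} refl)

lower-other : ∀ t {e} → e ≢ suc (suc t) → lower t e ≡ e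
lower-other t {e} e≢ = cong (if_then suc t else e) (≡ᵇ-false e≢)

lower-≤ : ∀ t e → lower t e ≤ e
lower-≤ t e with e ≟ℕ suc (suc t)
... | yes refl = ≤-trans (≤-reflexive (lower-top t)) (n≤1+n _)
... | no e≢    = ≤-reflexive (lower-other t e≢)

lower-InRange : ∀ t {i e} → InRange i e → InRange i (lower t e)
lower-InRange t {i} {e} (1≤e , e≤i) with e ≟ℕ suc (suc t)
... | yes refl = subst (InRange i) (sym (lower-top t)) (s≤s z≤n , ≤-trans (n≤1+n _) e≤i)
... | no e≢    = subst (InRange i) (sym (lower-other t e≢)) (1≤e , e≤i)

lower-mono-≤ : ∀ t {x y} → y ≢ suc t → y ≤ x → lower t y ≤ lower t x
lower-mono-≤ t {x} {y} y≢ y≤x with x ≟ℕ suc (suc t)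
... | no x≢    = subst (lower t y ≤_) (sym (lower-other t x≢)) (≤-trans (lower-≤ t y) y≤x)
... | yes refl with y ≟ℕ suc (suc t)
...   | yes refl = ≤-refl
...   | no y≢′   = subst₂ _≤_ (sym (lower-other t y≢′)) (sym (lower-top t)) (≤-pred (≤∧≢⇒< y≤x y≢′))

lower-mono-< : ∀ t {x y} → x ≢ suc t → x < y → lower t x < lower t y
lower-mono-< t {x} {y} x≢ x<y with y ≟ℕ suc (suc t)
... | yes refl = subst (lower t x <_) (sym (lower-top t)) (≤-<-trans (lower-≤ t x) (≤∧≢⇒< (≤-pred x<y) x≢))
... | no y≢    = subst (lower t x <_) (sym (lower-other t y≢)) (≤-<-trans (lower-≤ t x) x<y)

countℕ-lower-merged : ∀ t Y → All (_≢ suc t) Y → countℕ (suc t) (map (lower t) Y) ≡ countℕ (suc (suc t)) Y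
countℕ-lower-merged t Y none = countℕ-map (lower t) (suc t) (suc (suc t)) (All.map iff none)
  where
  iff : ∀ {e} → e ≢ suc t → lower t e ≡ suc t ⇔ e ≡ suc (suc t)
  iff {e} e≢ with e ≟ℕ suc (suc t)
  ... | yes e≡ = mk⇔ (λ _ → e≡) (λ { refl → lower-top t })
  ... | no e≢′ = mk⇔ (λ eq → ⊥-elim (e≢ (trans (sym (lower-other t e≢′)) eq))) (λ eq → ⊥-elim (e≢′ eq))

countℕ-lower-vacated : ∀ t Y → countℕ (suc (suc t)) (map (lower t) Y) ≡ 0
countℕ-lower-vacated t Y = Equivalence.from (countℕ≡0⇔ _ (map (lower t) Y)) (All.map⁺ (All.tabulate {xs = Y} (λ {e} _ → lower≢ e)))
  where
  lower≢ : ∀ e → lower t e ≢ suc (suc t)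
  lower≢ e with e ≟ℕ suc (suc t)
  ... | yes refl = λ eq → <⇒≢ (n<1+n (suc t)) (trans (sym (lower-top t)) eq)
  ... | no e≢    = λ eq → e≢ (trans (sym (lower-other t e≢)) eq)

countℕ-lower-unchanged : ∀ t {u} Y → u ≢ suc t → u ≢ suc (suc t) → countℕ u (map (lower t) Y) ≡ countℕ u Y
countℕ-lower-unchanged t {u} Y u≢ u≢′ = countℕ-map (lower t) u u (All.tabulate {xs = Y} (λ {e} _ → iff e))
  where
  iff : ∀ e → lower t e ≡ u ⇔ e ≡ u
  iff e with e ≟ℕ suc (suc t)
  ... | yes refl = mk⇔ (λ eq → ⊥-elim (u≢ (trans (sym eq) (lower-top t)))) (λ eq → ⊥-elim (u≢′ (sym eq)))
  ... | no e≢    = mk⇔ (trans (sym (lower-other t e≢))) (trans (lower-other t e≢))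

lowerFilling : ℕ → List (List ℕ) → List (List ℕ)
lowerFilling t = map (map (lower t))

FundFilling-lower : ∀ t {X} → All (All (_≢ suc t)) X → FundFilling X → FundFilling (lowerFilling t X)
FundFilling-lower t none (rows , sep) =
  All.map⁺ (All.zipWith (λ (noneR , sorted) → AllPairs-map-resp (lower t) noneR (λ _ y≢ → lower-mono-≤ t y≢) sorted) (none , rows)) ,
  AllPairs-map-resp (map (lower t)) none
    (λ noneR _ R≪S → All.map⁺ (All.zipWith (λ (x≢ , x<S) → All.map⁺ (All.map (lower-mono-< t x≢) x<S)) (noneR , R≪S)))
    sep

Constant-lower : ∀ t {X} → All Constant X → All Constant (lowerFilling t X)
Constant-lower t = All.map⁺ ∘ All.map row
  where
  row : ∀ {r} → Constant r → Constant (map (lower t) r)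
  row {[]}    _     = tt
  row {x ∷ r} r≡x = All.map⁺ (All.map (cong (lower t)) r≡x)

RowsBounded-lower : ∀ t i {X} → RowsBounded i X → RowsBounded i (lowerFilling t X)
RowsBounded-lower t i {[]}    _                  = tt
RowsBounded-lower t i {r ∷ X} (r-in , bounded) = All.map⁺ (All.map (lower-InRange t) r-in) , RowsBounded-lower t (suc i) bounded

map-length-lowerFilling : ∀ t X → map length (lowerFilling t X) ≡ map length X
map-length-lowerFilling t X = trans (sym (map-∘ X)) (map-cong (length-map (lower t)) X)

applyUpTo-swap : ∀ (h h′ : ℕ → ℕ) {n} P {x y Q} → applyUpTo h n ≡ P ++ x ∷ y ∷ Q →
  (∀ m → m ≢ length P → m ≢ suc (length P) → h′ m ≡ h m) → h′ (length P) ≡ y → h′ (suc (length P)) ≡ x →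
  applyUpTo h′ n ≡ P ++ y ∷ x ∷ Q
applyUpTo-swap h h′ {suc (suc n)} [] eq same h′₀ h′₁ =
  cong₂ _∷_ h′₀ (cong₂ _∷_ h′₁ (trans (applyUpTo-cong< n (λ m _ → same (suc (suc m)) (λ ()) (λ ()))) (∷-injectiveʳ (∷-injectiveʳ eq))))
applyUpTo-swap h h′ {suc n} (p ∷ P) eq same h′ᵢ h′ᵢ₊₁ =
  cong₂ _∷_ (trans (same 0 (λ ()) (λ ())) (∷-injectiveˡ eq))
    (applyUpTo-swap (h ∘ suc) (h′ ∘ suc) P (∷-injectiveʳ eq) (λ m m≢ m≢′ → same (suc m) (m≢ ∘ suc-injective) (m≢′ ∘ suc-injective)) h′ᵢ h′ᵢ₊₁)

toList-reverse-++-∷-∷ : ∀ {n} (c : Vec ℕ n) {us x y vs} → toList c ≡ us ++ x ∷ y ∷ vs → toList (Vec.reverse c) ≡ reverse vs ++ y ∷ x ∷ reverse us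
toList-reverse-++-∷-∷ c {us} {x} {y} {vs} c≡ = begin
  toList (Vec.reverse c)                   ≡⟨ Vec.toList-reverse c ⟩
  reverse (toList c)                       ≡⟨ cong reverse c≡ ⟩
  reverse (us ++ x ∷ y ∷ vs)               ≡⟨ reverse-++ us (x ∷ y ∷ vs) ⟩
  reverse (x ∷ y ∷ vs) ++ reverse us       ≡⟨ cong (_++ reverse us) (reverse-++ (x ∷ y ∷ []) vs) ⟩
  (reverse vs ++ y ∷ x ∷ []) ++ reverse us ≡⟨ ++-assoc (reverse vs) (y ∷ x ∷ []) (reverse us) ⟩
  reverse vs ++ y ∷ x ∷ reverse us         ∎
  where open ≡-Reasoning

module Slides (P : List (List ℕ) → Bool)
  (P-canonical : ∀ ks → T (P (canonicalFrom 1 ks)))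
  (P-lower : ∀ t {X} → All (All (_≢ suc t)) X → T (P X) → T (P (lowerFilling t X)))
  where

  slide : ∀ {n} → Vec ℕ n → Poly n
  slide {n} a = map (weightOf n) (filterᵇ P (candidates a))

  shape∈slide : ∀ {n} (a : Vec ℕ n) → a ∈ slide a
  shape∈slide a = ∈-map-filterᵇ⁺
    (subst (λ ks → canonicalFrom 1 (toList a) ∈ product (rowCandidates 1 ks)) (map-length-canonicalFrom 1 (toList a))
      (∈-rowCandidates⁺ 1 _ (canonicalFrom-RowsBounded 1 (toList a) ≤-refl)))
    (P-canonical (toList a)) (weight-canonicalFrom a)

  -- If no entry equals t + 1, relabelling t + 2 as t + 1 gives another filling of the same shape.
  slide-down : ∀ {n} (d : Vec ℕ n) {c} us v vs → toList c ≡ us ++ 0 ∷ v ∷ vs → c ∈ slide d →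
    ∃[ c′ ] toList c′ ≡ us ++ v ∷ 0 ∷ vs × c′ ∈ slide d
  slide-down {n} d us v vs c≡ c∈ with ∈-map-filterᵇ⁻ (candidates d) c∈
  ... | X , X∈ , PX , refl =
    weightOf n X′ , weight′ , ∈-map-filterᵇ⁺ X′∈ (P-lower t none PX) refl
    where
    t  = length us
    X′ = lowerFilling t X
    counts : applyUpTo (λ m → countℕ (suc m) (concat X)) n ≡ us ++ 0 ∷ v ∷ vs
    counts = trans (sym (toList-seqMonomial n (concat X))) c≡
    none : All (All (_≢ suc t)) X
    none = All.concat⁻ (Equivalence.to (countℕ≡0⇔ (suc t) (concat X)) (applyUpTo-at _ us counts))
    X′∈ : X′ ∈ candidates d
    X′∈ with ∈-rowCandidates⁻ 1 (toList d) X∈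
    ... | lengths , bounded = subst (λ ks → X′ ∈ product (rowCandidates 1 ks)) (trans (map-length-lowerFilling t X) lengths)
                                (∈-rowCandidates⁺ 1 X′ (RowsBounded-lower t 1 bounded))
    concat-X′ : concat X′ ≡ map (lower t) (concat X)
    concat-X′ = concat-map X
    count-t+2 : countℕ (suc (suc t)) (concat X) ≡ v
    count-t+2 = subst (λ i → countℕ (suc i) (concat X) ≡ v) (trans (length-++ us) (+-comm t 1))
      (applyUpTo-at _ (us ++ [ 0 ]) (trans counts (sym (++-assoc us [ 0 ] (v ∷ vs)))))
    unchanged : ∀ m → m ≢ t → m ≢ suc t → countℕ (suc m) (concat X′) ≡ countℕ (suc m) (concat X)
    unchanged m m≢ m≢′ = trans (cong (countℕ (suc m)) concat-X′)
      (countℕ-lower-unchanged t (concat X) (m≢ ∘ suc-injective) (m≢′ ∘ suc-injective))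
    merged : countℕ (suc t) (concat X′) ≡ v
    merged = trans (cong (countℕ (suc t)) concat-X′) (trans (countℕ-lower-merged t (concat X) (All.concat⁺ none)) count-t+2)
    vacated : countℕ (suc (suc t)) (concat X′) ≡ 0
    vacated = trans (cong (countℕ (suc (suc t))) concat-X′) (countℕ-lower-vacated t (concat X))
    weight′ : toList (weightOf n X′) ≡ us ++ v ∷ 0 ∷ vs
    weight′ = trans (toList-seqMonomial n (concat X′)) (applyUpTo-swap _ _ us counts unchanged merged vacated)

  -- x^a lies in slide a, so reversed it is a term of slide (reverse b); sliding down there and reversing
  -- back yields a term of slide a that fails to dominate a.
  slide≉young : ∀ {n} (a b : Vec ℕ n) us v vs → toList a ≡ us ++ v ∷ 0 ∷ vs → 0 < v →
    ¬ (slide a ≈ₚ reverseVars (slide (Vec.reverse b)))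
  slide≉young {n} a b us v vs a≡ 0<v slide≈young = <⇒≱ 0<v (+-cancelˡ-≤ (sum us) v 0 (begin
    sum us + v             ≡⟨ cong (sum us +_) (+-identityʳ v) ⟨
    sum us + (v + 0)       ≡⟨ sum-++ us [ v ] ⟨
    sum (us ++ [ v ])      ≤⟨ dominance a X∈ (us ++ [ v ]) {us′ = us ++ [ 0 ]} (trans a≡ (sym (++-assoc us [ v ] (0 ∷ vs)))) weight′ (trans (length-++ us) (sym (length-++ us))) ⟩
    sum (us ++ [ 0 ])      ≡⟨ sum-++ us [ 0 ] ⟩
    sum us + 0             ∎))
    where
    open ≤-Reasoning
    slid = slide-down (Vec.reverse b) (reverse vs) v (reverse us) (toList-reverse-++-∷-∷ a a≡)
             (∈-reverseVars⁻ (∈-resp-≈ₚ slide≈young (shape∈slide a)))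
    c′ = proj₁ slid
    term = ∈-map-filterᵇ⁻ (candidates a) (∈-resp-≈ₚ (λ c → sym (slide≈young c)) (∈-map⁺ Vec.reverse (proj₂ (proj₂ slid))))
    X  = proj₁ term
    X∈ = proj₁ (proj₂ term)
    weight′ : toList (weightOf n X) ≡ (us ++ [ 0 ]) ++ v ∷ vs
    weight′ = trans (cong toList (proj₂ (proj₂ (proj₂ term))))
      (trans (toList-reverse-++-∷-∷ c′ (proj₁ (proj₂ slid)))
      (trans (cong₂ (λ p q → p ++ 0 ∷ v ∷ q) (reverse-involutive us) (reverse-involutive vs)) (sym (++-assoc us [ 0 ] (v ∷ vs)))))

fundSlide≉youngFundSlide : ∀ {n} (a b : Vec ℕ n) us v vs → toList a ≡ us ++ v ∷ 0 ∷ vs → 0 < v → ¬ (fundSlide a ≈ₚ youngFundSlide b)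
fundSlide≉youngFundSlide = Slides.slide≉young isFundFilling
  (λ ks → Equivalence.from T-isFundFilling (proj₁ (canonicalFrom-MonFilling 1 ks)))
  (λ t none fund → Equivalence.from T-isFundFilling (FundFilling-lower t none (Equivalence.to T-isFundFilling fund)))

monSlide≉youngMonSlide : ∀ {n} (a b : Vec ℕ n) us v vs → toList a ≡ us ++ v ∷ 0 ∷ vs → 0 < v → ¬ (monSlide a ≈ₚ youngMonSlide b)
monSlide≉youngMonSlide = Slides.slide≉young isMonFilling
  (λ ks → Equivalence.from T-isMonFilling (canonicalFrom-MonFilling 1 ks))
  (λ t none mon → let (fund , constant) = Equivalence.to T-isMonFilling mon
                  in Equivalence.from T-isMonFilling (FundFilling-lower t none fund , Constant-lower t constant))

-- The characterisation

zeros++positive⊎gap : ∀ xs → (∃[ k ] ∃[ α ] xs ≡ replicate k 0 ++ α × All (0 <_) α)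
                           ⊎ (∃[ us ] ∃[ v ] ∃[ vs ] xs ≡ us ++ v ∷ 0 ∷ vs × 0 < v)
zeros++positive⊎gap [] = inj₁ (0 , [] , refl , [])
zeros++positive⊎gap (x ∷ xs) with x | zeros++positive⊎gap xs
... | zero  | inj₁ (k , α , refl , pos)      = inj₁ (suc k , α , refl , pos)
... | suc x | inj₁ (zero , α , refl , pos)   = inj₁ (0 , suc x ∷ α , refl , z<s ∷ pos)
... | suc x | inj₁ (suc k , α , refl , pos)  = inj₂ ([] , suc x , replicate k 0 ++ α , refl , z<s)
... | x     | inj₂ (us , v , vs , refl , 0<v) = inj₂ (x ∷ us , v , vs , refl , 0<v)

vecOf : ∀ {n} (xs : List ℕ) → length xs ≡ n → Σ (Vec ℕ n) λ v → toList v ≡ xs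
vecOf xs |xs| = Vec.cast |xs| (Vec.fromList xs) , trans (Vec.toList-cast |xs| (Vec.fromList xs)) (Vec.toList∘fromList xs)

module _ (slide young : ∀ {n} → Vec ℕ n → Poly n) (qsym : (n : ℕ) → List ℕ → Poly n)
  (slide≈ : ∀ {n k α} (a : Vec ℕ n) → toList a ≡ replicate k 0 ++ α → All (0 <_) α → slide a ≈ₚ qsym n α)
  (young≈ : ∀ {n k α} (b : Vec ℕ n) → toList b ≡ α ++ replicate k 0 → All (0 <_) α → young b ≈ₚ qsym n α)
  (slide≉young : ∀ {n} (a b : Vec ℕ n) us v vs → toList a ≡ us ++ v ∷ 0 ∷ vs → 0 < v → ¬ (slide a ≈ₚ young b))
  where

  slide-and-young⇔qsym : ∀ n (p : Poly n) →
    ((∃[ a ] p ≈ₚ slide a) × (∃[ b ] p ≈ₚ young b)) ⇔ (∃[ α ] (IsComposition n α × p ≈ₚ qsym n α))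
  slide-and-young⇔qsym n p = mk⇔ to from
    where
    to : (∃[ a ] p ≈ₚ slide a) × (∃[ b ] p ≈ₚ young b) → ∃[ α ] (IsComposition n α × p ≈ₚ qsym n α)
    to ((a , p≈a) , (b , p≈b)) with zeros++positive⊎gap (toList a)
    ... | inj₁ (k , α , a≡ , pos) = α , (pos , |α|≤n) , λ c → trans (p≈a c) (slide≈ a a≡ pos c)
      where
      |α|≤n = subst (length α ≤_) (trans (cong length (sym a≡)) (Vec.length-toList a))
                (subst (length α ≤_) (sym (trans (length-++ (replicate k 0)) (cong (_+ length α) (length-replicate k)))) (m≤n+m (length α) k))
    ... | inj₂ (us , v , vs , a≡ , 0<v) = ⊥-elim (slide≉young a b us v vs a≡ 0<v λ c → trans (sym (p≈a c)) (p≈b c))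
    from : ∃[ α ] (IsComposition n α × p ≈ₚ qsym n α) → (∃[ a ] p ≈ₚ slide a) × (∃[ b ] p ≈ₚ young b)
    from (α , (pos , |α|≤n) , p≈α) =
      let k = n ∸ length α
          (a , a≡) = vecOf (replicate k 0 ++ α) (trans (length-++ (replicate k 0)) (trans (cong (_+ length α) (length-replicate k)) (m∸n+n≡m |α|≤n)))
          (b , b≡) = vecOf (α ++ replicate k 0) (trans (length-++ α) (trans (cong (length α +_) (length-replicate k)) (m+[n∸m]≡n |α|≤n)))
      in (a , λ c → trans (p≈α c) (sym (slide≈ a a≡ pos c))) , (b , λ c → trans (p≈α c) (sym (young≈ b b≡ pos c)))

mainTheorem13 : (n : ℕ) → (p : Poly n) →
    (((∃[ a ] p ≈ₚ fundSlide {n} a) × (∃[ b ] p ≈ₚ youngFundSlide {n} b))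
       ⇔ (∃[ α ] (IsComposition n α × p ≈ₚ fundQSym n α)))
    ×
    (((∃[ a ] p ≈ₚ monSlide {n} a) × (∃[ b ] p ≈ₚ youngMonSlide {n} b))
       ⇔ (∃[ α ] (IsComposition n α × p ≈ₚ monQSym n α)))
mainTheorem13 n p =
  slide-and-young⇔qsym fundSlide youngFundSlide fundQSym (λ a → ZeroPadded.fundSlide≈ a) youngFundSlide≈ fundSlide≉youngFundSlide n p ,
  slide-and-young⇔qsym monSlide youngMonSlide monQSym (λ a → ZeroPadded.monSlide≈ a) youngMonSlide≈ monSlide≉youngMonSlide n p
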